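{- Let $n_1,\ldots,n_s$ be distinct positive integers and $r_1,\ldots,r_s$ positive integers, and let $G=K_{r_1.n_1,\ldots,r_s.n_s}$ be the complete multipartite graph having exactly $r_i$ parts of size $n_i$ for each $i=1,\ldots,s$. Put $k=\sum_{i=1}^s r_i$ and $n=\sum_{i=1}^s r_in_i$. Then $$S_G(\lambda)=(\lambda +1)^{n-k} \prod_{i=1}^{s}(\lambda+1-2n_i)^{r_i-1} \Big(\prod_{i=1}^{s}(\lambda+1-2n_i)+\sum_{i=1}^{s}r_in_i \prod_{j\neq i}(\lambda+1-2n_j)\Big).$$
   Context: For a simple graph $G$ with adjacency matrix $A(G)$, the Seidel matrix is $S(G)=J-I-2A(G)$, where $I$ is the identity matrix and $J$ the all-ones matrix. The Seidel characteristic polynomial is $S_G(\lambda)=\det(\lambda I-S(G))$. The complete multipartite graph $K_{n_1,\ldots,n_k}$ has vertex set partitioned into parts $V_1,\ldots,V_k$ with $|V_i|=n_i$, two vertices being adjacent iff they lie in different parts. -}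

module Defs where

open import Data.Nat as ℕ using (ℕ; zero; suc)
open import Data.Bool using (Bool; true; false; if_then_else_; _∧_)
open import Data.Fin using (Fin; zero; suc; toℕ; punchIn)
open import Data.Integer using (ℤ; +_; -_; _+_; _-_; _*_; _^_; 0ℤ; 1ℤ)
open import Data.Product using (Σ; Σ-syntax; _,_; proj₁; proj₂)
open import Function.Bundles using (_↔_; Inverse)

∑ : ∀ m → (Fin m → ℤ) → ℤ
∑ zero    f = 0ℤ
∑ (suc m) f = f zero + ∑ m (λ i → f (suc i))

∏ : ∀ m → (Fin m → ℤ) → ℤ
∏ zero    f = 1ℤ
∏ (suc m) f = f zero * ∏ m (λ i → f (suc i))

∑ℕ : ∀ m → (Fin m → ℕ) → ℕ
∑ℕ zero    f = 0
∑ℕ (suc m) f = f zero ℕ.+ ∑ℕ m (λ i → f (suc i))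

_==ᶠ_ : ∀ {m} → Fin m → Fin m → Bool
a ==ᶠ b = toℕ a ℕ.≡ᵇ toℕ b

∏≠ : ∀ m → Fin m → (Fin m → ℤ) → ℤ
∏≠ m i f = ∏ m (λ j → if j ==ᶠ i then 1ℤ else f j)

Matrix : ℕ → Set
Matrix N = Fin N → Fin N → ℤ

det : ∀ N → Matrix N → ℤ
det zero    M = 1ℤ
det (suc N) M =
  ∑ (suc N) (λ j → ((- 1ℤ) ^ toℕ j) * (M zero j * det N (λ a b → M (suc a) (punchIn j b))))

δ : ∀ {N} → Fin N → Fin N → ℤ
δ a b = if a ==ᶠ b then 1ℤ else 0ℤ

Graph : ℕ → Set
Graph N = Fin N → Fin N → Bool

adjMatrix : ∀ {N} → Graph N → Matrix N
adjMatrix G u v = if G u v then 1ℤ else 0ℤ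

seidel : ∀ {N} → Graph N → Matrix N
seidel G u v = 1ℤ - δ u v - (+ 2) * adjMatrix G u v

seidelCharPoly : ∀ {N} → Graph N → ℤ → ℤ
seidelCharPoly {N} G x = det N (λ u v → x * δ u v - seidel G u v)

-- Vertex type of K_{r_1.n_1,...,r_s.n_s}: a vertex is (i , c , e) meaning element e
-- of the c-th copy (c < r_i) of a part of size n_i.  The part of a vertex is (i , c).
MVert : (s : ℕ) → (Fin s → ℕ) → (Fin s → ℕ) → Set
MVert s n r = Σ[ i ∈ Fin s ] Σ[ c ∈ Fin (r i) ] Fin (n i)

samePart : ∀ {s n r} → MVert s n r → MVert s n r → Bool
samePart (i , c , _) (i' , c' , _) = (toℕ i ℕ.≡ᵇ toℕ i') ∧ (toℕ c ℕ.≡ᵇ toℕ c')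

completeMultipartite : ∀ {N} (s : ℕ) (n r : Fin s → ℕ) → (Fin N ↔ MVert s n r) → Graph N
completeMultipartite s n r lab u v =
  if samePart (Inverse.to lab u) (Inverse.to lab v) then false else true

-- λI − S(G) = (λ + 1) I + J − 2B, where B u v = 1 iff u and v lie in the same part.
-- For D = diag d and any partition of the vertices,
--   det (D + xJ − 2B) = ∏_P β_P + x ∑_P α_P ∏_{Q ≠ P} β_Q,
-- where β_P = det (D_P − 2J) and α_P = ∑_{u ∈ P} ∏_{v ∈ P, v ≠ u} d_v. This goes by induction
-- on the vertices: linearity in row 0 splits off d₀ times a minor, and once d₀ = 0 either
-- another vertex w of the same part has row d_w e_w + (row 0), or vertex 0 is alone, its row
-- is x𝟙 − 2e₀, and subtracting x𝟙 from the other rows clears column 0. For G all d_u = λ + 1,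
-- so a part of size m has α = m (λ + 1)^(m − 1) and β = (λ + 1)^(m − 1) (λ + 1 − 2m), and
-- grouping the r_i parts of size n_i gives the formula.

module Submission where

open import Defs
open import Data.Nat as ℕ using (ℕ; zero; suc; _∸_)
open import Data.Nat.Properties as ℕₚ using ()
open import Data.Fin using (Fin; zero; suc; toℕ; punchIn; _↑ˡ_; _↑ʳ_; splitAt)
open import Data.Fin.Properties using (_≟_; punchInᵢ≢i; punchIn-injective; any?; toℕ-↑ˡ; toℕ-↑ʳ; toℕ<n;
  splitAt-↑ˡ; splitAt-↑ʳ; splitAt⁻¹-↑ˡ; splitAt⁻¹-↑ʳ)
open import Data.Product using (Σ; _,_; proj₁; proj₂; map₂)
open import Data.Sum using (_⊎_; inj₁; inj₂; map₁)
open import Data.Integer using (ℤ; +_; -_; _+_; _*_; _-_; _^_; 0ℤ; 1ℤ; +[1+_]; -[1+_])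
open import Data.Integer.Properties as ℤ using ()
open import Data.Integer.Tactic.RingSolver using (solve-∀)
open import Data.Bool using (Bool; true; false; if_then_else_; _∧_)
open import Data.Vec.Functional using (updateAt)
open import Data.Vec.Functional.Properties using (updateAt-updates; updateAt-minimal)
open import Function using (_∘_; const)
open import Function.Bundles using (_↔_; Inverse; mk↔ₛ′)
open import Function.Definitions using (Injective)
import Algebra.Properties.CommutativeMonoid.Sum as CommutativeMonoidSum
import Algebra.Properties.CommutativeSemigroup as CommutativeSemigroupProperties
open import Relation.Nullary using (does; yes; no; contradiction)
open import Relation.Nullary.Decidable using (dec-true; dec-false)
open import Relation.Binary.PropositionalEquality
  using (_≡_; _≢_; refl; sym; trans; cong; cong₂; cong-app; subst; module ≡-Reasoning)

open ≡-Reasoning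

-- Sums and Kronecker deltas over Fin

∑-cong : ∀ m {f g : Fin m → ℤ} → (∀ i → f i ≡ g i) → ∑ m f ≡ ∑ m g
∑-cong zero    f≗g = refl
∑-cong (suc m) f≗g = cong₂ _+_ (f≗g zero) (∑-cong m (f≗g ∘ suc))

∑-zero : ∀ m {f : Fin m → ℤ} → (∀ i → f i ≡ 0ℤ) → ∑ m f ≡ 0ℤ
∑-zero zero    f≗0 = refl
∑-zero (suc m) f≗0 = cong₂ _+_ (f≗0 zero) (∑-zero m (f≗0 ∘ suc))

∑-distrib-+ : ∀ m (f g : Fin m → ℤ) → ∑ m (λ i → f i + g i) ≡ ∑ m f + ∑ m g
∑-distrib-+ zero    f g = refl
∑-distrib-+ (suc m) f g =
  trans (cong (_+_ (f zero + g zero)) (∑-distrib-+ m (f ∘ suc) (g ∘ suc)))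
        (interchange (f zero) (g zero) (∑ m (f ∘ suc)) (∑ m (g ∘ suc)))
  where
  interchange : ∀ (a b c d : ℤ) → (a + b) + (c + d) ≡ (a + c) + (b + d)
  interchange = solve-∀

*-distribˡ-∑ : ∀ m (c : ℤ) (f : Fin m → ℤ) → c * ∑ m f ≡ ∑ m (λ i → c * f i)
*-distribˡ-∑ zero    c f = ℤ.*-zeroʳ c
*-distribˡ-∑ (suc m) c f =
  trans (ℤ.*-distribˡ-+ c (f zero) _) (cong (_+_ (c * f zero)) (*-distribˡ-∑ m c (f ∘ suc)))

∑-neg : ∀ m (f : Fin m → ℤ) → ∑ m (λ i → - f i) ≡ - ∑ m f
∑-neg zero    f = refl
∑-neg (suc m) f =
  trans (cong (_+_ (- f zero)) (∑-neg m (f ∘ suc))) (sym (ℤ.neg-distrib-+ (f zero) _))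

∑-remove : ∀ m (c : Fin (suc m)) (f : Fin (suc m) → ℤ) → ∑ (suc m) f ≡ f c + ∑ m (f ∘ punchIn c)
∑-remove m       zero    f = refl
∑-remove (suc m) (suc c) f =
  trans (cong (_+_ (f zero)) (∑-remove m c (f ∘ suc))) (swap (f zero) (f (suc c)) _)
  where
  swap : ∀ (a b d : ℤ) → a + (b + d) ≡ b + (a + d)
  swap = solve-∀

∑-select : ∀ m (u : Fin m) (g : Fin m → ℤ) → ∑ m (λ l → δ u l * g l) ≡ g u
∑-select (suc m) zero    g =
  trans (cong₂ _+_ (ℤ.*-identityˡ (g zero)) (∑-zero m (λ l → ℤ.*-zeroˡ (g (suc l)))))
        (ℤ.+-identityʳ (g zero))
∑-select (suc m) (suc u) g = trans (ℤ.+-identityˡ _) (∑-select m u (g ∘ suc))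

==ᶠ-does : ∀ {m} (a b : Fin m) → (a ==ᶠ b) ≡ does (a ≟ b)
==ᶠ-does zero    zero    = refl
==ᶠ-does zero    (suc b) = refl
==ᶠ-does (suc a) zero    = refl
==ᶠ-does (suc a) (suc b) = ==ᶠ-does a b

==ᶠ-refl : ∀ {m} (a : Fin m) → (a ==ᶠ a) ≡ true
==ᶠ-refl a = trans (==ᶠ-does a a) (dec-true (a ≟ a) refl)

==ᶠ-≢ : ∀ {m} {a b : Fin m} → a ≢ b → (a ==ᶠ b) ≡ false
==ᶠ-≢ {a = a} {b} a≢b = trans (==ᶠ-does a b) (dec-false (a ≟ b) a≢b)

δ-refl : ∀ {m} (a : Fin m) → δ a a ≡ 1ℤ
δ-refl a = cong (if_then 1ℤ else 0ℤ) (==ᶠ-refl a)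

δ-≢ : ∀ {m} {a b : Fin m} → a ≢ b → δ a b ≡ 0ℤ
δ-≢ a≢b = cong (if_then 1ℤ else 0ℤ) (==ᶠ-≢ a≢b)

δ-sym : ∀ {m} (a b : Fin m) → δ a b ≡ δ b a
δ-sym a b with a ≟ b
... | yes refl = refl
... | no a≢b   = trans (δ-≢ a≢b) (sym (δ-≢ (a≢b ∘ sym)))

δ-punchIn : ∀ {m} (w : Fin (suc m)) (a b : Fin m) → δ (punchIn w a) (punchIn w b) ≡ δ a b
δ-punchIn w a b with a ≟ b
... | yes refl = trans (δ-refl (punchIn w a)) (sym (δ-refl a))
... | no a≢b   = trans (δ-≢ (a≢b ∘ punchIn-injective w a b)) (sym (δ-≢ a≢b))

-- Laplace expansion

sgn : ℕ → ℤ
sgn n = (- 1ℤ) ^ n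

sgn-+ : ∀ m n → sgn (m ℕ.+ n) ≡ sgn m * sgn n
sgn-+ = ℤ.^-distribˡ-+-* (- 1ℤ)

sgn-suc : ∀ n → sgn (suc n) ≡ - sgn n
sgn-suc n = ℤ.-1*i≡-i (sgn n)

sgn-suc-+-suc : ∀ m n → sgn (suc m ℕ.+ suc n) ≡ sgn (m ℕ.+ n)
sgn-suc-+-suc m n = begin
  sgn (suc (m ℕ.+ suc n))  ≡⟨ sgn-suc (m ℕ.+ suc n) ⟩
  - sgn (m ℕ.+ suc n)      ≡⟨ cong (-_ ∘ sgn) (ℕₚ.+-suc m n) ⟩
  - sgn (suc (m ℕ.+ n))    ≡⟨ cong -_ (sgn-suc (m ℕ.+ n)) ⟩
  - - sgn (m ℕ.+ n)        ≡⟨ ℤ.neg-involutive _ ⟩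
  sgn (m ℕ.+ n)            ∎

sgn-double : ∀ n → sgn (n ℕ.+ n) ≡ 1ℤ
sgn-double zero    = refl
sgn-double (suc n) = trans (sgn-suc-+-suc n n) (sgn-double n)

-- (c , j) ↦ (punchIn c j , opposite c j) is the involution exchanging the two
-- members of an ordered pair of distinct indices.
opposite : ∀ {n} → Fin (suc n) → Fin n → Fin n
opposite {suc n} zero    j       = zero
opposite {suc n} (suc c) zero    = c
opposite {suc n} (suc c) (suc j) = suc (opposite c j)

punchIn-opposite : ∀ {n} (c : Fin (suc n)) (j : Fin n) → punchIn (punchIn c j) (opposite c j) ≡ c
punchIn-opposite {suc n} zero    j       = refl
punchIn-opposite {suc n} (suc c) zero    = refl
punchIn-opposite {suc n} (suc c) (suc j) = cong suc (punchIn-opposite c j)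

punchIn-punchIn-opposite : ∀ {n} (c : Fin (suc (suc n))) (j : Fin (suc n)) (b : Fin n) →
  punchIn (punchIn c j) (punchIn (opposite c j) b) ≡ punchIn c (punchIn j b)
punchIn-punchIn-opposite zero    j       b       = refl
punchIn-punchIn-opposite (suc c) zero    b       = refl
punchIn-punchIn-opposite (suc c) (suc j) zero    = refl
punchIn-punchIn-opposite (suc c) (suc j) (suc b) = cong suc (punchIn-punchIn-opposite c j b)

sgn-punchIn-opposite : ∀ {n} (c : Fin (suc n)) (j : Fin n) →
  sgn (toℕ (punchIn c j) ℕ.+ toℕ (opposite c j)) ≡ - sgn (toℕ c ℕ.+ toℕ j)
sgn-punchIn-opposite {suc n} zero j =
  trans (cong sgn (ℕₚ.+-identityʳ (suc (toℕ j)))) (sgn-suc (toℕ j))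
sgn-punchIn-opposite {suc n} (suc c) zero = begin
  sgn (toℕ c)                       ≡⟨ ℤ.neg-involutive _ ⟨
  - - sgn (toℕ c)                   ≡⟨ cong -_ (sgn-suc (toℕ c)) ⟨
  - sgn (suc (toℕ c))               ≡⟨ cong (-_ ∘ sgn) (ℕₚ.+-identityʳ (suc (toℕ c))) ⟨
  - sgn (suc (toℕ c) ℕ.+ 0)         ∎
sgn-punchIn-opposite {suc n} (suc c) (suc j) =
  trans (sgn-suc-+-suc (toℕ (punchIn c j)) (toℕ (opposite c j)))
        (trans (sgn-punchIn-opposite c j) (cong -_ (sym (sgn-suc-+-suc (toℕ c) (toℕ j)))))

sgn-transposition : ∀ k {n} (c : Fin (suc n)) (j : Fin n) →
  sgn (toℕ (punchIn c j)) * sgn (k ℕ.+ toℕ (opposite c j)) ≡ - (sgn (toℕ c) * sgn (k ℕ.+ toℕ j))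
sgn-transposition k c j = begin
  P * sgn (k ℕ.+ toℕ (opposite c j))  ≡⟨ cong (P *_) (sgn-+ k (toℕ (opposite c j))) ⟩
  P * (K * O)                         ≡⟨ regroup P K O ⟩
  K * (P * O)                         ≡⟨ cong (K *_) (sgn-+ (toℕ (punchIn c j)) (toℕ (opposite c j))) ⟨
  K * sgn (toℕ (punchIn c j) ℕ.+ toℕ (opposite c j))
                                      ≡⟨ cong (K *_) (sgn-punchIn-opposite c j) ⟩
  K * - sgn (toℕ c ℕ.+ toℕ j)         ≡⟨ cong (λ z → K * - z) (sgn-+ (toℕ c) (toℕ j)) ⟩
  K * - (C * J)                       ≡⟨ regroup′ K C J ⟩
  - (C * (K * J))                     ≡⟨ cong (λ z → - (C * z)) (sgn-+ k (toℕ j)) ⟨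
  - (C * sgn (k ℕ.+ toℕ j))           ∎
  where
  P = sgn (toℕ (punchIn c j))
  O = sgn (toℕ (opposite c j))
  K = sgn k
  C = sgn (toℕ c)
  J = sgn (toℕ j)
  regroup : ∀ (p k o : ℤ) → p * (k * o) ≡ k * (p * o)
  regroup = solve-∀
  regroup′ : ∀ (k c j : ℤ) → k * - (c * j) ≡ - (c * (k * j))
  regroup′ = solve-∀

sgn-suc-transposition : ∀ k {n} (c : Fin (suc n)) (j : Fin n) →
  sgn (suc (k ℕ.+ toℕ (punchIn c j))) * sgn (toℕ (opposite c j)) ≡ sgn (toℕ c) * sgn (k ℕ.+ toℕ j)
sgn-suc-transposition k c j = begin
  sgn (suc (k ℕ.+ toℕ (punchIn c j))) * O
    ≡⟨ cong (_* O) (trans (sgn-suc (k ℕ.+ toℕ (punchIn c j))) (cong -_ (sgn-+ k (toℕ (punchIn c j))))) ⟩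
  - (K * P) * O                             ≡⟨ regroup K P O ⟩
  - (P * (K * O))                           ≡⟨ cong (λ z → - (P * z)) (sgn-+ k (toℕ (opposite c j))) ⟨
  - (P * sgn (k ℕ.+ toℕ (opposite c j)))    ≡⟨ cong -_ (sgn-transposition k c j) ⟩
  - - (sgn (toℕ c) * sgn (k ℕ.+ toℕ j))     ≡⟨ ℤ.neg-involutive _ ⟩
  sgn (toℕ c) * sgn (k ℕ.+ toℕ j)           ∎
  where
  K = sgn k
  P = sgn (toℕ (punchIn c j))
  O = sgn (toℕ (opposite c j))
  regroup : ∀ (k p o : ℤ) → - (k * p) * o ≡ - (p * (k * o))
  regroup = solve-∀

∑∑-opposite : ∀ n (G : Fin (suc n) → Fin n → ℤ) →
  ∑ (suc n) (λ c → ∑ n (G c)) ≡ ∑ (suc n) (λ c → ∑ n (λ j → G (punchIn c j) (opposite c j)))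
∑∑-opposite zero    G = refl
∑∑-opposite (suc n) G = begin
  (G zero zero + A) + ∑ (suc n) (λ c → G (suc c) zero + ∑ n (G (suc c) ∘ suc))
    ≡⟨ cong (_+_ (G zero zero + A)) (∑-distrib-+ (suc n) (λ c → G (suc c) zero) (λ c → ∑ n (G (suc c) ∘ suc))) ⟩
  (G zero zero + A) + (B + D)
    ≡⟨ cong (λ z → (G zero zero + A) + (B + z)) (∑∑-opposite n (λ c j → G (suc c) (suc j))) ⟩
  (G zero zero + A) + (B + D′)
    ≡⟨ swap (G zero zero + A) B D′ ⟩
  B + ((G zero zero + A) + D′)
    ≡⟨ cong (_+_ B) (∑-distrib-+ (suc n) (G zero) (λ c → ∑ n (λ j → G (suc (punchIn c j)) (suc (opposite c j))))) ⟨
  B + ∑ (suc n) (λ c → G zero c + ∑ n (λ j → G (suc (punchIn c j)) (suc (opposite c j))))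
    ∎
  where
  A  = ∑ n (G zero ∘ suc)
  B  = ∑ (suc n) (λ c → G (suc c) zero)
  D  = ∑ (suc n) (λ c → ∑ n (G (suc c) ∘ suc))
  D′ = ∑ (suc n) (λ c → ∑ n (λ j → G (suc (punchIn c j)) (suc (opposite c j))))
  swap : ∀ (g b d : ℤ) → g + (b + d) ≡ b + (g + d)
  swap = solve-∀

minor : ∀ {N} → Matrix (suc N) → Fin (suc N) → Fin (suc N) → Matrix N
minor A i j a b = A (punchIn i a) (punchIn j b)

det-cong : ∀ N {A B : Matrix N} → (∀ a b → A a b ≡ B a b) → det N A ≡ det N B
det-cong zero    A≗B = refl
det-cong (suc N) A≗B = ∑-cong (suc N) (λ j →
  cong₂ (λ x y → sgn (toℕ j) * (x * y)) (A≗B zero j) (det-cong N (λ a b → A≗B (suc a) (punchIn j b))))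

-- The row vector r expanded against the cofactors of row u of A; for r = A u
-- this is the Laplace expansion of det A along row u.
cofactorExpansion : ∀ {N} → Matrix (suc N) → Fin (suc N) → (Fin (suc N) → ℤ) → ℤ
cofactorExpansion {N} A u r = ∑ (suc N) (λ l → sgn (toℕ u ℕ.+ toℕ l) * (r l * det N (minor A u l)))

cofactorExpansion-cong : ∀ {N} {A B : Matrix (suc N)} (u : Fin (suc N)) {r s : Fin (suc N) → ℤ} →
  (∀ a b → A (punchIn u a) b ≡ B (punchIn u a) b) → (∀ l → r l ≡ s l) →
  cofactorExpansion A u r ≡ cofactorExpansion B u s
cofactorExpansion-cong {N} u A≗B r≗s = ∑-cong (suc N) (λ l →
  cong₂ (λ x y → sgn (toℕ u ℕ.+ toℕ l) * (x * y)) (r≗s l) (det-cong N (λ a b → A≗B a (punchIn l b))))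

cofactorExpansion-linear : ∀ {N} (A : Matrix (suc N)) u (r s : Fin (suc N) → ℤ) (c : ℤ) →
  cofactorExpansion A u (λ l → r l + c * s l) ≡ cofactorExpansion A u r + c * cofactorExpansion A u s
cofactorExpansion-linear {N} A u r s c = begin
  ∑ (suc N) (λ l → σ l * ((r l + c * s l) * M l))    ≡⟨ ∑-cong (suc N) (λ l → distrib (σ l) (r l) (s l) c (M l)) ⟩
  ∑ (suc N) (λ l → σ l * (r l * M l) + c * (σ l * (s l * M l)))
      ≡⟨ ∑-distrib-+ (suc N) (λ l → σ l * (r l * M l)) (λ l → c * (σ l * (s l * M l))) ⟩
  cofactorExpansion A u r + ∑ (suc N) (λ l → c * (σ l * (s l * M l)))
      ≡⟨ cong (_+_ (cofactorExpansion A u r)) (*-distribˡ-∑ (suc N) c (λ l → σ l * (s l * M l))) ⟨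
  cofactorExpansion A u r + c * cofactorExpansion A u s  ∎
  where
  σ = λ l → sgn (toℕ u ℕ.+ toℕ l)
  M = λ l → det N (minor A u l)
  distrib : ∀ (σ r s c m : ℤ) → σ * ((r + c * s) * m) ≡ σ * (r * m) + c * (σ * (s * m))
  distrib = solve-∀

cofactorExpansion-unit : ∀ {N} (A : Matrix (suc N)) u → cofactorExpansion A u (δ u) ≡ det N (minor A u u)
cofactorExpansion-unit {N} A u = begin
  ∑ (suc N) (λ l → sgn (toℕ u ℕ.+ toℕ l) * (δ u l * det N (minor A u l)))
    ≡⟨ ∑-cong (suc N) (λ l → regroup (sgn (toℕ u ℕ.+ toℕ l)) (δ u l) (det N (minor A u l))) ⟩
  ∑ (suc N) (λ l → δ u l * (sgn (toℕ u ℕ.+ toℕ l) * det N (minor A u l)))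
    ≡⟨ ∑-select (suc N) u (λ l → sgn (toℕ u ℕ.+ toℕ l) * det N (minor A u l)) ⟩
  sgn (toℕ u ℕ.+ toℕ u) * det N (minor A u u)
    ≡⟨ cong (_* det N (minor A u u)) (sgn-double (toℕ u)) ⟩
  1ℤ * det N (minor A u u)
    ≡⟨ ℤ.*-identityˡ _ ⟩
  det N (minor A u u)  ∎
  where
  regroup : ∀ (s d m : ℤ) → s * (d * m) ≡ d * (s * m)
  regroup = solve-∀

*-*-distribˡ-∑ : ∀ m (c d : ℤ) (f : Fin m → ℤ) → c * (d * ∑ m f) ≡ ∑ m (λ i → c * (d * f i))
*-*-distribˡ-∑ m c d f = trans (cong (c *_) (*-distribˡ-∑ m d f)) (*-distribˡ-∑ m c (λ i → d * f i))

-- The term of det A using column j in row 0 and column l of the minor at (0 , j)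
-- in row suc u.
laplaceTerm : ∀ {m} (A : Matrix (suc (suc m))) → Fin (suc m) → Fin (suc (suc m)) → Fin (suc m) → ℤ
laplaceTerm {m} A u j l =
  sgn (toℕ j) * (A zero j * (sgn (toℕ u ℕ.+ toℕ l) *
    (A (suc u) (punchIn j l) * det m (λ a b → A (suc (punchIn u a)) (punchIn j (punchIn l b))))))

laplaceTerm-opposite : ∀ {m} (A : Matrix (suc (suc m))) u j l →
  laplaceTerm A u (punchIn j l) (opposite j l)
    ≡ sgn (toℕ (punchIn j l)) * (A zero (punchIn j l) * (sgn (toℕ u ℕ.+ toℕ (opposite j l)) *
        (A (suc u) j * det m (λ a b → A (suc (punchIn u a)) (punchIn j (punchIn l b))))))
laplaceTerm-opposite {m} A u j l =
  cong₂ (λ x y → sgn (toℕ (punchIn j l)) * (A zero (punchIn j l) * (sgn (toℕ u ℕ.+ toℕ (opposite j l)) * (x * y))))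
    (cong (A (suc u)) (punchIn-opposite j l))
    (det-cong m (λ a b → cong (A (suc (punchIn u a))) (punchIn-punchIn-opposite j l b)))

det-expandRow : ∀ N (A : Matrix (suc N)) u → det (suc N) A ≡ cofactorExpansion A u (A u)

det-doubleExpansion : ∀ m (A : Matrix (suc (suc m))) u →
  det (suc (suc m)) A ≡ ∑ (suc (suc m)) (λ j → ∑ (suc m) (laplaceTerm A u j))
det-doubleExpansion m A u = ∑-cong (suc (suc m)) (λ j →
  trans (cong (λ z → sgn (toℕ j) * (A zero j * z)) (det-expandRow m (minor A zero j) u))
        (*-*-distribˡ-∑ (suc m) (sgn (toℕ j)) (A zero j) (λ l → sgn (toℕ u ℕ.+ toℕ l) *
          (A (suc u) (punchIn j l) * det m (λ a b → A (suc (punchIn u a)) (punchIn j (punchIn l b)))))))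

det-expandRow N       A zero    = refl
det-expandRow (suc n) A (suc u) = begin
  det (suc (suc n)) A
    ≡⟨ det-doubleExpansion n A u ⟩
  ∑ (suc (suc n)) (λ j → ∑ (suc n) (laplaceTerm A u j))
    ≡⟨ ∑-cong (suc (suc n)) (λ j → ∑-cong (suc n) (λ l → sym (rowSwap j l))) ⟩
  ∑ (suc (suc n)) (λ j → ∑ (suc n) (λ l → R (punchIn j l) (opposite j l)))
    ≡⟨ ∑∑-opposite (suc n) R ⟨
  ∑ (suc (suc n)) (λ l → ∑ (suc n) (R l))
    ≡⟨ ∑-cong (suc (suc n)) (λ l → *-*-distribˡ-∑ (suc n) (sgn (suc (toℕ u ℕ.+ toℕ l))) (A (suc u) l)
         (λ j → sgn (toℕ j) * (A zero (punchIn l j) * det n (λ a b → A (suc (punchIn u a)) (punchIn l (punchIn j b)))))) ⟨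
  cofactorExpansion A (suc u) (A (suc u))  ∎
  where
  -- the same term, expanded along row suc u first
  R : Fin (suc (suc n)) → Fin (suc n) → ℤ
  R l j = sgn (suc (toℕ u ℕ.+ toℕ l)) * (A (suc u) l * (sgn (toℕ j) *
            (A zero (punchIn l j) * det n (λ a b → A (suc (punchIn u a)) (punchIn l (punchIn j b))))))
  rowSwap : ∀ j l → R (punchIn j l) (opposite j l) ≡ laplaceTerm A u j l
  rowSwap j l = begin
    R (punchIn j l) (opposite j l)
      ≡⟨ cong₂ (λ x y → S * (A (suc u) (punchIn j l) * (O * (x * y))))
           (cong (A zero) (punchIn-opposite j l))
           (det-cong n (λ a b → cong (A (suc (punchIn u a))) (punchIn-punchIn-opposite j l b))) ⟩
    S * (A (suc u) (punchIn j l) * (O * (A zero j * D)))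
      ≡⟨ factor S O (A (suc u) (punchIn j l)) (A zero j) D ⟩
    (S * O) * (A (suc u) (punchIn j l) * (A zero j * D))
      ≡⟨ cong (_* (A (suc u) (punchIn j l) * (A zero j * D))) (sgn-suc-transposition (toℕ u) j l) ⟩
    (sgn (toℕ j) * sgn (toℕ u ℕ.+ toℕ l)) * (A (suc u) (punchIn j l) * (A zero j * D))
      ≡⟨ unfactor (sgn (toℕ j)) (sgn (toℕ u ℕ.+ toℕ l)) (A (suc u) (punchIn j l)) (A zero j) D ⟩
    laplaceTerm A u j l  ∎
    where
    S = sgn (suc (toℕ u ℕ.+ toℕ (punchIn j l)))
    O = sgn (toℕ (opposite j l))
    D = det n (λ a b → A (suc (punchIn u a)) (punchIn j (punchIn l b)))
    factor : ∀ (s o a b d : ℤ) → s * (a * (o * (b * d))) ≡ (s * o) * (a * (b * d))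
    factor = solve-∀
    unfactor : ∀ (j l a b d : ℤ) → (j * l) * (a * (b * d)) ≡ j * (b * (l * (a * d)))
    unfactor = solve-∀

self-negating : ∀ {x : ℤ} → x ≡ - x → x ≡ 0ℤ
self-negating {x = + zero}    _  = refl
self-negating {x = +[1+ _ ]} ()
self-negating {x = -[1+ _ ]} ()

-- Exchanging the columns used by the two equal rows 0 and suc k flips the sign
-- of a term, so the double expansion is its own negative.
det-equalRows₀ : ∀ m (A : Matrix (suc (suc m))) k → (∀ b → A zero b ≡ A (suc k) b) →
  det (suc (suc m)) A ≡ 0ℤ
det-equalRows₀ m A k rows≡ = trans (det-doubleExpansion m A k) (self-negating (begin
  S                                                                       ≡⟨ ∑∑-opposite (suc m) (laplaceTerm A k) ⟩
  ∑ (suc (suc m)) (λ j → ∑ (suc m) (λ l → laplaceTerm A k (punchIn j l) (opposite j l)))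
    ≡⟨ ∑-cong (suc (suc m)) (λ j → ∑-cong (suc m) (antisymmetric j)) ⟩
  ∑ (suc (suc m)) (λ j → ∑ (suc m) (λ l → - laplaceTerm A k j l))
    ≡⟨ ∑-cong (suc (suc m)) (λ j → ∑-neg (suc m) (laplaceTerm A k j)) ⟩
  ∑ (suc (suc m)) (λ j → - ∑ (suc m) (laplaceTerm A k j))
    ≡⟨ ∑-neg (suc (suc m)) (λ j → ∑ (suc m) (laplaceTerm A k j)) ⟩
  - S                                                                     ∎))
  where
  S = ∑ (suc (suc m)) (λ j → ∑ (suc m) (laplaceTerm A k j))
  antisymmetric : ∀ j l → laplaceTerm A k (punchIn j l) (opposite j l) ≡ - laplaceTerm A k j l
  antisymmetric j l = begin
    laplaceTerm A k (punchIn j l) (opposite j l)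
      ≡⟨ laplaceTerm-opposite A k j l ⟩
    P * (A zero (punchIn j l) * (O * (A (suc k) j * D)))
      ≡⟨ cong₂ (λ x y → P * (x * (O * (y * D)))) (rows≡ (punchIn j l)) (sym (rows≡ j)) ⟩
    P * (A (suc k) (punchIn j l) * (O * (A zero j * D)))
      ≡⟨ factor P O (A (suc k) (punchIn j l)) (A zero j) D ⟩
    (P * O) * (A (suc k) (punchIn j l) * (A zero j * D))
      ≡⟨ cong (_* (A (suc k) (punchIn j l) * (A zero j * D))) (sgn-transposition (toℕ k) j l) ⟩
    - (sgn (toℕ j) * sgn (toℕ k ℕ.+ toℕ l)) * (A (suc k) (punchIn j l) * (A zero j * D))
      ≡⟨ unfactor (sgn (toℕ j)) (sgn (toℕ k ℕ.+ toℕ l)) (A (suc k) (punchIn j l)) (A zero j) D ⟩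
    - laplaceTerm A k j l  ∎
    where
    P = sgn (toℕ (punchIn j l))
    O = sgn (toℕ k ℕ.+ toℕ (opposite j l))
    D = det m (λ a b → A (suc (punchIn k a)) (punchIn j (punchIn l b)))
    factor : ∀ (p o a b d : ℤ) → p * (a * (o * (b * d))) ≡ (p * o) * (a * (b * d))
    factor = solve-∀
    unfactor : ∀ (j l a b d : ℤ) → - (j * l) * (a * (b * d)) ≡ - (j * (b * (l * (a * d))))
    unfactor = solve-∀

det-equalRows : ∀ N (A : Matrix N) (i k : Fin N) → i ≢ k → (∀ b → A i b ≡ A k b) → det N A ≡ 0ℤ
det-equalRows (suc N)       A zero    zero    i≢k _     = contradiction refl i≢k
det-equalRows (suc (suc m)) A zero    (suc k) _   rows≡ = det-equalRows₀ m A k rows≡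
det-equalRows (suc (suc m)) A (suc i) zero    _   rows≡ = det-equalRows₀ m A i (sym ∘ rows≡)
det-equalRows (suc N)       A (suc i) (suc k) i≢k rows≡ = ∑-zero (suc N) (λ j →
  trans (cong (λ z → sgn (toℕ j) * (A zero j * z))
          (det-equalRows N (minor A zero j) i k (i≢k ∘ cong suc) (rows≡ ∘ punchIn j)))
        (trans (cong (sgn (toℕ j) *_) (ℤ.*-zeroʳ (A zero j))) (ℤ.*-zeroʳ (sgn (toℕ j)))))

cofactorExpansion-otherRow : ∀ {N} (A : Matrix (suc N)) {u v} → v ≢ u → cofactorExpansion A u (A v) ≡ 0ℤ
cofactorExpansion-otherRow {N} A {u} {v} v≢u = begin
  cofactorExpansion A u (A v)  ≡⟨ cofactorExpansion-cong {A = A} {B = W} u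
                                    (λ a → cong-app (sym (offRow (punchIn u a) (punchInᵢ≢i u a)))) (cong-app (sym atRow)) ⟩
  cofactorExpansion W u (W u)  ≡⟨ det-expandRow N W u ⟨
  det (suc N) W                ≡⟨ det-equalRows (suc N) W v u v≢u (cong-app (trans (offRow v v≢u) (sym atRow))) ⟩
  0ℤ                           ∎
  where
  W : Matrix (suc N)
  W = updateAt A u (const (A v))
  offRow : ∀ w → w ≢ u → W w ≡ A w
  offRow w w≢u = updateAt-minimal w u A w≢u
  atRow : W u ≡ A v
  atRow = updateAt-updates u A

det-addRow₀Multiples : ∀ N (A B : Matrix (suc N)) (c : Fin N → ℤ) →
  (∀ b → A zero b ≡ B zero b) → (∀ a b → A (suc a) b ≡ B (suc a) b + c a * B zero b) →
  det (suc N) A ≡ det (suc N) B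
det-addRow₀Multiples zero    A B c row₀≡ rows≡ = det-cong 1 sameRows
  where
  sameRows : ∀ a b → A a b ≡ B a b
  sameRows zero b = row₀≡ b
det-addRow₀Multiples (suc n) A B c row₀≡ rows≡ = begin
  det (suc (suc n)) A
    ≡⟨ det-expandRow (suc n) A row₁ ⟩
  cofactorExpansion A row₁ (A row₁)
    ≡⟨ cofactorExpansion-cong {A = A} {B = A} row₁ (λ _ _ → refl)
         (λ l → trans (rows≡ zero l) (cong (λ z → B row₁ l + c zero * z) (sym (row₀≡ l)))) ⟩
  cofactorExpansion A row₁ (λ l → B row₁ l + c zero * A zero l)
    ≡⟨ cofactorExpansion-linear A row₁ (B row₁) (A zero) (c zero) ⟩
  cofactorExpansion A row₁ (B row₁) + c zero * cofactorExpansion A row₁ (A zero)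
    ≡⟨ cong (λ z → cofactorExpansion A row₁ (B row₁) + c zero * z) (cofactorExpansion-otherRow A {row₁} {zero} (λ ())) ⟩
  cofactorExpansion A row₁ (B row₁) + c zero * 0ℤ
    ≡⟨ trans (cong (_+_ (cofactorExpansion A row₁ (B row₁))) (ℤ.*-zeroʳ (c zero))) (ℤ.+-identityʳ _) ⟩
  cofactorExpansion A row₁ (B row₁)
    ≡⟨ ∑-cong (suc (suc n)) (λ l → cong (λ z → sgn (suc (toℕ l)) * (B row₁ l * z))
         (det-addRow₀Multiples n (minor A row₁ l) (minor B row₁ l) (c ∘ suc)
           (row₀≡ ∘ punchIn l) (λ a → rows≡ (suc a) ∘ punchIn l))) ⟩
  cofactorExpansion B row₁ (B row₁)
    ≡⟨ det-expandRow (suc n) B row₁ ⟨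
  det (suc (suc n)) B  ∎
  where
  row₁ : Fin (suc (suc n))
  row₁ = suc zero

det-zeroColumn : ∀ N (A : Matrix N) (c : Fin N) → (∀ a → A a c ≡ 0ℤ) → det N A ≡ 0ℤ
det-zeroColumn (suc n) A c column≡0 = begin
  det (suc n) A                                   ≡⟨ ∑-remove n c term ⟩
  term c + ∑ n (term ∘ punchIn c)                 ≡⟨ cong₂ _+_ vanishes-at-c (∑-zero n vanishes-off-c) ⟩
  0ℤ                                              ∎
  where
  term : Fin (suc n) → ℤ
  term j = sgn (toℕ j) * (A zero j * det n (minor A zero j))
  vanishes-at-c : term c ≡ 0ℤ
  vanishes-at-c = trans (cong (λ z → sgn (toℕ c) * (z * det n (minor A zero c))) (column≡0 zero))
                        (ℤ.*-zeroʳ (sgn (toℕ c)))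
  vanishes-off-c : ∀ j → term (punchIn c j) ≡ 0ℤ
  vanishes-off-c j = begin
    sgn (toℕ (punchIn c j)) * (A zero (punchIn c j) * det n (minor A zero (punchIn c j)))
      ≡⟨ cong (λ z → sgn (toℕ (punchIn c j)) * (A zero (punchIn c j) * z))
           (det-zeroColumn n (minor A zero (punchIn c j)) (opposite c j)
             (λ a → trans (cong (A (suc a)) (punchIn-opposite c j)) (column≡0 (suc a)))) ⟩
    sgn (toℕ (punchIn c j)) * (A zero (punchIn c j) * 0ℤ)
      ≡⟨ trans (cong (sgn (toℕ (punchIn c j)) *_) (ℤ.*-zeroʳ (A zero (punchIn c j))))
               (ℤ.*-zeroʳ (sgn (toℕ (punchIn c j)))) ⟩
    0ℤ  ∎

det-column₀Zero : ∀ N (A : Matrix (suc N)) → (∀ a → A (suc a) zero ≡ 0ℤ) →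
  det (suc N) A ≡ A zero zero * det N (minor A zero zero)
det-column₀Zero N A column₀≡0 = begin
  1ℤ * (A zero zero * det N (minor A zero zero)) + ∑ N (term ∘ suc)
    ≡⟨ cong (_+_ (1ℤ * (A zero zero * det N (minor A zero zero)))) (∑-zero N vanishes) ⟩
  1ℤ * (A zero zero * det N (minor A zero zero)) + 0ℤ
    ≡⟨ trans (ℤ.+-identityʳ _) (ℤ.*-identityˡ _) ⟩
  A zero zero * det N (minor A zero zero)  ∎
  where
  term : Fin (suc N) → ℤ
  term j = sgn (toℕ j) * (A zero j * det N (minor A zero j))
  -- column 0 of A sits at position opposite zero j of the minor at (0 , suc j)
  vanishes : ∀ j → term (suc j) ≡ 0ℤ
  vanishes j = begin
    sgn (suc (toℕ j)) * (A zero (suc j) * det N (minor A zero (suc j)))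
      ≡⟨ cong (λ z → sgn (suc (toℕ j)) * (A zero (suc j) * z))
           (det-zeroColumn N (minor A zero (suc j)) (opposite zero j)
             (λ a → trans (cong (A (suc a)) (punchIn-opposite zero j)) (column₀≡0 a))) ⟩
    sgn (suc (toℕ j)) * (A zero (suc j) * 0ℤ)
      ≡⟨ trans (cong (sgn (suc (toℕ j)) *_) (ℤ.*-zeroʳ (A zero (suc j)))) (ℤ.*-zeroʳ (sgn (suc (toℕ j)))) ⟩
    0ℤ  ∎

-- Determinant of D + xJ − 2B

-- D + x J - 2 B for D = diag d and B u v = [p u = p v]; λ I - S(G) is the case
-- d = λ + 1, x = 1, p = the part of a vertex.
partMatrix : ∀ {N t} → ℤ → (Fin N → Fin t) → (Fin N → ℤ) → Matrix N
partMatrix x p d u v = d u * δ u v + (x - + 2 * δ (p u) (p v))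

det-partMatrix-splitDiag₀ : ∀ {N t} x (p : Fin (suc N) → Fin t) d →
  det (suc N) (partMatrix x p d)
    ≡ det (suc N) (partMatrix x p (updateAt d zero (const 0ℤ))) + d zero * det N (partMatrix x (p ∘ suc) (d ∘ suc))
det-partMatrix-splitDiag₀ {N} x p d = begin
  cofactorExpansion M zero (M zero)
    ≡⟨ cofactorExpansion-cong {A = M} {B = M₀} zero (λ _ _ → refl)
         (λ l → split (d zero) (δ zero l) (x - + 2 * δ (p zero) (p l))) ⟩
  cofactorExpansion M₀ zero (λ l → M₀ zero l + d zero * δ zero l)
    ≡⟨ cofactorExpansion-linear M₀ zero (M₀ zero) (δ zero) (d zero) ⟩
  det (suc N) M₀ + d zero * cofactorExpansion M₀ zero (δ zero)
    ≡⟨ cong (λ z → det (suc N) M₀ + d zero * z) (cofactorExpansion-unit M₀ zero) ⟩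
  det (suc N) M₀ + d zero * det N (partMatrix x (p ∘ suc) (d ∘ suc))  ∎
  where
  M  = partMatrix x p d
  M₀ = partMatrix x p (updateAt d zero (const 0ℤ))
  split : ∀ (d δ y : ℤ) → d * δ + y ≡ (0ℤ * δ + y) + d * δ
  split = solve-∀

det-partMatrix-sharedPart : ∀ {n t} x (p : Fin (suc (suc n)) → Fin t) d (w : Fin (suc n)) →
  d zero ≡ 0ℤ → p (suc w) ≡ p zero →
  det (suc (suc n)) (partMatrix x p d)
    ≡ d (suc w) * det (suc n) (partMatrix x (p ∘ punchIn (suc w)) (d ∘ punchIn (suc w)))
det-partMatrix-sharedPart {n} x p d w d₀≡0 same = begin
  det (suc (suc n)) M
    ≡⟨ det-expandRow (suc n) M (suc w) ⟩
  cofactorExpansion M (suc w) (M (suc w))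
    ≡⟨ cofactorExpansion-cong {A = M} {B = M} (suc w) (λ _ _ → refl) row≡ ⟩
  cofactorExpansion M (suc w) (λ l → M zero l + d (suc w) * δ (suc w) l)
    ≡⟨ cofactorExpansion-linear M (suc w) (M zero) (δ (suc w)) (d (suc w)) ⟩
  cofactorExpansion M (suc w) (M zero) + d (suc w) * cofactorExpansion M (suc w) (δ (suc w))
    ≡⟨ cong₂ (λ y z → y + d (suc w) * z)
         (cofactorExpansion-otherRow M {suc w} {zero} (λ ())) (cofactorExpansion-unit M (suc w)) ⟩
  0ℤ + d (suc w) * det (suc n) (minor M (suc w) (suc w))
    ≡⟨ ℤ.+-identityˡ (d (suc w) * det (suc n) (minor M (suc w) (suc w))) ⟩
  d (suc w) * det (suc n) (minor M (suc w) (suc w))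
    ≡⟨ cong (d (suc w) *_) (det-cong (suc n) (λ a b →
         cong (λ z → d (punchIn (suc w) a) * z + (x - + 2 * δ (p (punchIn (suc w) a)) (p (punchIn (suc w) b))))
              (δ-punchIn (suc w) a b))) ⟩
  d (suc w) * det (suc n) (partMatrix x (p ∘ punchIn (suc w)) (d ∘ punchIn (suc w)))  ∎
  where
  M = partMatrix x p d
  row≡ : ∀ l → M (suc w) l ≡ M zero l + d (suc w) * δ (suc w) l
  row≡ l = begin
    d (suc w) * δ (suc w) l + (x - + 2 * δ (p (suc w)) (p l))
      ≡⟨ cong (λ q → d (suc w) * δ (suc w) l + (x - + 2 * δ q (p l))) same ⟩
    d (suc w) * δ (suc w) l + y
      ≡⟨ regroup (d (suc w)) (δ (suc w) l) y (δ zero l) ⟩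
    (0ℤ * δ zero l + y) + d (suc w) * δ (suc w) l
      ≡⟨ cong (λ z → (z * δ zero l + y) + d (suc w) * δ (suc w) l) d₀≡0 ⟨
    M zero l + d (suc w) * δ (suc w) l  ∎
    where
    y = x - + 2 * δ (p zero) (p l)
    regroup : ∀ (e δw y δ₀ : ℤ) → e * δw + y ≡ (0ℤ * δ₀ + y) + e * δw
    regroup = solve-∀

δ-isolated : ∀ {N t} (p : Fin (suc N) → Fin t) → (∀ w → p (suc w) ≢ p zero) →
  ∀ l → δ (p zero) (p l) ≡ δ zero l
δ-isolated p isolated zero    = δ-refl (p zero)
δ-isolated p isolated (suc w) = δ-≢ (isolated w ∘ sym)

-- Row 0 is x 𝟙 - 2 e₀; subtracting the row x 𝟙 from the others leaves column 0
-- zero below row 0.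
det-partMatrix-isolated : ∀ {N t} x (p : Fin (suc N) → Fin t) d →
  d zero ≡ 0ℤ → (∀ w → p (suc w) ≢ p zero) →
  det (suc N) (partMatrix x p d)
    ≡ x * det N (partMatrix 0ℤ (p ∘ suc) (d ∘ suc)) - + 2 * det N (partMatrix x (p ∘ suc) (d ∘ suc))
det-partMatrix-isolated {N} x p d d₀≡0 isolated = begin
  cofactorExpansion M zero (M zero)
    ≡⟨ cofactorExpansion-cong {A = M} {B = M} zero (λ _ _ → refl) row₀≡ ⟩
  cofactorExpansion M zero (λ l → x + - + 2 * δ zero l)
    ≡⟨ cofactorExpansion-linear M zero (const x) (δ zero) (- + 2) ⟩
  det (suc N) T + - + 2 * cofactorExpansion M zero (δ zero)
    ≡⟨ cong₂ (λ y z → y + - + 2 * z)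
         (det-addRow₀Multiples N T B (const 1ℤ) (λ _ → refl) rows≡) (cofactorExpansion-unit M zero) ⟩
  det (suc N) B + - + 2 * det N (partMatrix x (p ∘ suc) (d ∘ suc))
    ≡⟨ cong (λ z → z + - + 2 * det N (partMatrix x (p ∘ suc) (d ∘ suc))) (det-column₀Zero N B column₀≡0) ⟩
  x * det N (partMatrix 0ℤ (p ∘ suc) (d ∘ suc)) + - + 2 * det N (partMatrix x (p ∘ suc) (d ∘ suc))
    ≡⟨ neg-* (x * det N (partMatrix 0ℤ (p ∘ suc) (d ∘ suc))) (det N (partMatrix x (p ∘ suc) (d ∘ suc))) ⟩
  x * det N (partMatrix 0ℤ (p ∘ suc) (d ∘ suc)) - + 2 * det N (partMatrix x (p ∘ suc) (d ∘ suc))  ∎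
  where
  neg-* : ∀ (y z : ℤ) → y + - + 2 * z ≡ y - + 2 * z
  neg-* = solve-∀
  M = partMatrix x p d
  T : Matrix (suc N)
  T zero    b = x
  T (suc a) b = M (suc a) b
  B : Matrix (suc N)
  B zero    b = x
  B (suc a) b = partMatrix 0ℤ p d (suc a) b
  row₀≡ : ∀ l → M zero l ≡ x + - + 2 * δ zero l
  row₀≡ l = begin
    d zero * δ zero l + (x - + 2 * δ (p zero) (p l))
      ≡⟨ cong₂ (λ e z → e * δ zero l + (x - + 2 * z)) d₀≡0 (δ-isolated p isolated l) ⟩
    0ℤ * δ zero l + (x - + 2 * δ zero l)              ≡⟨ simplify x (δ zero l) ⟩
    x + - + 2 * δ zero l                              ∎
    where
    simplify : ∀ (x δ₀ : ℤ) → 0ℤ * δ₀ + (x - + 2 * δ₀) ≡ x + - + 2 * δ₀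
    simplify = solve-∀
  rows≡ : ∀ a b → T (suc a) b ≡ B (suc a) b + 1ℤ * B zero b
  rows≡ a b = shift (d (suc a) * δ (suc a) b) (+ 2 * δ (p (suc a)) (p b)) x
    where
    shift : ∀ (e f x : ℤ) → e + (x - f) ≡ (e + (0ℤ - f)) + 1ℤ * x
    shift = solve-∀
  column₀≡0 : ∀ a → B (suc a) zero ≡ 0ℤ
  column₀≡0 a =
    trans (cong (λ z → d (suc a) * 0ℤ + (0ℤ - + 2 * z)) (trans (δ-sym (p (suc a)) (p zero)) (δ-isolated p isolated (suc a))))
          (vanish (d (suc a)))
    where
    vanish : ∀ (e : ℤ) → e * 0ℤ + (0ℤ - + 2 * 0ℤ) ≡ 0ℤ
    vanish = solve-∀

-- Products and their derivatives

-- ∂∏ t β α = ∑ᵢ αᵢ ∏_{j ≠ i} βⱼ, the derivative of ∏ β in the direction α.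
∂∏ : ∀ t → (Fin t → ℤ) → (Fin t → ℤ) → ℤ
∂∏ zero    β α = 0ℤ
∂∏ (suc t) β α = β zero * ∂∏ t (β ∘ suc) (α ∘ suc) + α zero * ∏ t (β ∘ suc)

∏-cong : ∀ t {f g : Fin t → ℤ} → (∀ i → f i ≡ g i) → ∏ t f ≡ ∏ t g
∏-cong zero    f≗g = refl
∏-cong (suc t) f≗g = cong₂ _*_ (f≗g zero) (∏-cong t (f≗g ∘ suc))

∂∏-cong : ∀ t {β β′ α α′ : Fin t → ℤ} → (∀ i → β i ≡ β′ i) → (∀ i → α i ≡ α′ i) →
  ∂∏ t β α ≡ ∂∏ t β′ α′
∂∏-cong zero    β≗β′ α≗α′ = refl
∂∏-cong (suc t) β≗β′ α≗α′ =
  cong₂ _+_ (cong₂ _*_ (β≗β′ zero) (∂∏-cong t (β≗β′ ∘ suc) (α≗α′ ∘ suc)))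
            (cong₂ _*_ (α≗α′ zero) (∏-cong t (β≗β′ ∘ suc)))

∏-remove : ∀ t (c : Fin (suc t)) (β : Fin (suc t) → ℤ) → ∏ (suc t) β ≡ β c * ∏ t (β ∘ punchIn c)
∏-remove t       zero    β = refl
∏-remove (suc t) (suc c) β =
  trans (cong (β zero *_) (∏-remove t c (β ∘ suc))) (swap (β zero) (β (suc c)) (∏ t (β ∘ suc ∘ punchIn c)))
  where
  swap : ∀ (a b p : ℤ) → a * (b * p) ≡ b * (a * p)
  swap = solve-∀

∂∏-remove : ∀ t (c : Fin (suc t)) (β α : Fin (suc t) → ℤ) →
  ∂∏ (suc t) β α ≡ β c * ∂∏ t (β ∘ punchIn c) (α ∘ punchIn c) + α c * ∏ t (β ∘ punchIn c)
∂∏-remove t       zero    β α = refl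
∂∏-remove (suc t) (suc c) β α = begin
  β zero * ∂∏ (suc t) (β ∘ suc) (α ∘ suc) + α zero * ∏ (suc t) (β ∘ suc)
    ≡⟨ cong₂ (λ y z → β zero * y + α zero * z) (∂∏-remove t c (β ∘ suc) (α ∘ suc)) (∏-remove t c (β ∘ suc)) ⟩
  β zero * (β (suc c) * ∂′ + α (suc c) * ∏′) + α zero * (β (suc c) * ∏′)
    ≡⟨ regroup (β zero) (α zero) (β (suc c)) (α (suc c)) ∂′ ∏′ ⟩
  β (suc c) * (β zero * ∂′ + α zero * ∏′) + α (suc c) * (β zero * ∏′)  ∎
  where
  ∂′ = ∂∏ t (β ∘ suc ∘ punchIn c) (α ∘ suc ∘ punchIn c)
  ∏′ = ∏ t (β ∘ suc ∘ punchIn c)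
  regroup : ∀ (b a b′ a′ d p : ℤ) → b * (b′ * d + a′ * p) + a * (b′ * p) ≡ b′ * (b * d + a * p) + a′ * (b * p)
  regroup = solve-∀

-- ∏ β + x ∂∏ β α is det (diag β + x α 𝟙ᵀ).
partDet : ℤ → ∀ t → (Fin t → ℤ) → (Fin t → ℤ) → ℤ
partDet x t β α = ∏ t β + x * ∂∏ t β α

partDet-remove : ∀ x t (c : Fin (suc t)) (β α : Fin (suc t) → ℤ) →
  partDet x (suc t) β α ≡ β c * partDet x t (β ∘ punchIn c) (α ∘ punchIn c) + x * (α c * ∏ t (β ∘ punchIn c))
partDet-remove x t c β α = begin
  ∏ (suc t) β + x * ∂∏ (suc t) β α
    ≡⟨ cong₂ (λ y z → y + x * z) (∏-remove t c β) (∂∏-remove t c β α) ⟩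
  β c * ∏′ + x * (β c * ∂′ + α c * ∏′)
    ≡⟨ regroup x (β c) (α c) ∏′ ∂′ ⟩
  β c * (∏′ + x * ∂′) + x * (α c * ∏′)  ∎
  where
  ∏′ = ∏ t (β ∘ punchIn c)
  ∂′ = ∂∏ t (β ∘ punchIn c) (α ∘ punchIn c)
  regroup : ∀ (x b a p d : ℤ) → b * p + x * (b * d + a * p) ≡ b * (p + x * d) + x * (a * p)
  regroup = solve-∀

partDet-cong : ∀ x t {β β′ α α′ : Fin t → ℤ} → (∀ i → β i ≡ β′ i) → (∀ i → α i ≡ α′ i) →
  partDet x t β α ≡ partDet x t β′ α′
partDet-cong x t β≗β′ α≗α′ = cong₂ (λ y z → y + x * z) (∏-cong t β≗β′) (∂∏-cong t β≗β′ α≗α′)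

partDiag : ∀ {N t} → (Fin N → Fin t) → (Fin N → ℤ) → Fin t → Fin N → ℤ
partDiag p d P u = if p u ==ᶠ P then d u else 1ℤ

partProd : ∀ {t} N → (Fin N → Fin t) → (Fin N → ℤ) → Fin t → ℤ
partProd N p d P = ∏ N (partDiag p d P)

partDeriv : ∀ {t} N → (Fin N → Fin t) → (Fin N → ℤ) → Fin t → ℤ
partDeriv N p d P = ∂∏ N (partDiag p d P) (λ u → δ (p u) P)

-- det (D_P - 2 J) for the diagonal block D_P of part P, by the matrix determinant lemma.
blockDet : ∀ {t} N → (Fin N → Fin t) → (Fin N → ℤ) → Fin t → ℤ
blockDet N p d P = partProd N p d P - + 2 * partDeriv N p d P

module _ {N t} (p : Fin (suc N) → Fin t) (d : Fin (suc N) → ℤ) (w : Fin (suc N)) where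

  private
    p′ = p ∘ punchIn w
    d′ = d ∘ punchIn w

  partProd-insert : partProd (suc N) p d (p w) ≡ d w * partProd N p′ d′ (p w)
  partProd-insert = trans (∏-remove N w (partDiag p d (p w)))
                          (cong (λ b → (if b then d w else 1ℤ) * partProd N p′ d′ (p w)) (==ᶠ-refl (p w)))

  partDeriv-insert : partDeriv (suc N) p d (p w) ≡ d w * partDeriv N p′ d′ (p w) + 1ℤ * partProd N p′ d′ (p w)
  partDeriv-insert = trans (∂∏-remove N w (partDiag p d (p w)) (λ u → δ (p u) (p w)))
    (cong₂ (λ y z → y * partDeriv N p′ d′ (p w) + z * partProd N p′ d′ (p w))
           (cong (if_then d w else 1ℤ) (==ᶠ-refl (p w))) (δ-refl (p w)))

  partProd-insertElsewhere : ∀ P → p w ≢ P → partProd (suc N) p d P ≡ partProd N p′ d′ P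
  partProd-insertElsewhere P p≢P = trans (∏-remove N w (partDiag p d P))
    (trans (cong (λ b → (if b then d w else 1ℤ) * partProd N p′ d′ P) (==ᶠ-≢ p≢P)) (ℤ.*-identityˡ _))

  partDeriv-insertElsewhere : ∀ P → p w ≢ P → partDeriv (suc N) p d P ≡ partDeriv N p′ d′ P
  partDeriv-insertElsewhere P p≢P = begin
    partDeriv (suc N) p d P
      ≡⟨ ∂∏-remove N w (partDiag p d P) (λ u → δ (p u) P) ⟩
    partDiag p d P w * partDeriv N p′ d′ P + δ (p w) P * partProd N p′ d′ P
      ≡⟨ cong₂ (λ y z → y * partDeriv N p′ d′ P + z * partProd N p′ d′ P)
           (cong (if_then d w else 1ℤ) (==ᶠ-≢ p≢P)) (δ-≢ p≢P) ⟩
    1ℤ * partDeriv N p′ d′ P + 0ℤ * partProd N p′ d′ P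
      ≡⟨ simplify (partDeriv N p′ d′ P) (partProd N p′ d′ P) ⟩
    partDeriv N p′ d′ P  ∎
    where
    simplify : ∀ (a b : ℤ) → 1ℤ * a + 0ℤ * b ≡ a
    simplify = solve-∀

-- partDet x (suc t) β α with part c replaced by a single vertex of weight 0,
-- i.e. with β c = - 2 and α c = 1.
partDet₀ : ℤ → ∀ t → (Fin (suc t) → ℤ) → (Fin (suc t) → ℤ) → Fin (suc t) → ℤ
partDet₀ x t β α c = x * ∏ t (β ∘ punchIn c) - + 2 * partDet x t (β ∘ punchIn c) (α ∘ punchIn c)

partDet-insert : ∀ {N t} x (p : Fin (suc N) → Fin (suc t)) d w →
  partDet x (suc t) (blockDet (suc N) p d) (partDeriv (suc N) p d)
    ≡ d w * partDet x (suc t) (blockDet N (p ∘ punchIn w) (d ∘ punchIn w)) (partDeriv N (p ∘ punchIn w) (d ∘ punchIn w))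
      + partProd N (p ∘ punchIn w) (d ∘ punchIn w) (p w)
        * partDet₀ x t (blockDet N (p ∘ punchIn w) (d ∘ punchIn w)) (partDeriv N (p ∘ punchIn w) (d ∘ punchIn w)) (p w)
partDet-insert {N} {t} x p d w = begin
  partDet x (suc t) β α
    ≡⟨ partDet-remove x t (p w) β α ⟩
  β (p w) * partDet x t (β ∘ punchIn (p w)) (α ∘ punchIn (p w)) + x * (α (p w) * ∏ t (β ∘ punchIn (p w)))
    ≡⟨ cong₂ (λ y z → y * z + x * (α (p w) * ∏ t (β ∘ punchIn (p w)))) β-at (partDet-cong x t β-off α-off) ⟩
  (d w * π′ - + 2 * (d w * α′ (p w) + 1ℤ * π′)) * B + x * (α (p w) * ∏ t (β ∘ punchIn (p w)))
    ≡⟨ cong₂ (λ y z → (d w * π′ - + 2 * (d w * α′ (p w) + 1ℤ * π′)) * B + x * (y * z))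
         (partDeriv-insert p d w) (∏-cong t β-off) ⟩
  (d w * π′ - + 2 * (d w * α′ (p w) + 1ℤ * π′)) * B + x * ((d w * α′ (p w) + 1ℤ * π′) * C)
    ≡⟨ regroup x (d w) π′ (α′ (p w)) B C ⟩
  d w * ((π′ - + 2 * α′ (p w)) * B + x * (α′ (p w) * C)) + π′ * (x * C - + 2 * B)
    ≡⟨ cong (λ z → d w * z + π′ * (x * C - + 2 * B)) (partDet-remove x t (p w) β′ α′) ⟨
  d w * partDet x (suc t) β′ α′ + π′ * partDet₀ x t β′ α′ (p w)  ∎
  where
  β  = blockDet (suc N) p d
  α  = partDeriv (suc N) p d
  β′ = blockDet N (p ∘ punchIn w) (d ∘ punchIn w)
  α′ = partDeriv N (p ∘ punchIn w) (d ∘ punchIn w)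
  π′ = partProd N (p ∘ punchIn w) (d ∘ punchIn w) (p w)
  B  = partDet x t (β′ ∘ punchIn (p w)) (α′ ∘ punchIn (p w))
  C  = ∏ t (β′ ∘ punchIn (p w))
  β-at : β (p w) ≡ d w * π′ - + 2 * (d w * α′ (p w) + 1ℤ * π′)
  β-at = cong₂ (λ y z → y - + 2 * z) (partProd-insert p d w) (partDeriv-insert p d w)
  α-off : ∀ Q → α (punchIn (p w) Q) ≡ α′ (punchIn (p w) Q)
  α-off Q = partDeriv-insertElsewhere p d w (punchIn (p w) Q) (punchInᵢ≢i (p w) Q ∘ sym)
  β-off : ∀ Q → β (punchIn (p w) Q) ≡ β′ (punchIn (p w) Q)
  β-off Q = cong₂ (λ y z → y - + 2 * z) (partProd-insertElsewhere p d w (punchIn (p w) Q) (punchInᵢ≢i (p w) Q ∘ sym)) (α-off Q)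
  regroup : ∀ (x e π a B C : ℤ) →
    (e * π - + 2 * (e * a + 1ℤ * π)) * B + x * ((e * a + 1ℤ * π) * C)
      ≡ e * ((π - + 2 * a) * B + x * (a * C)) + π * (x * C - + 2 * B)
  regroup = solve-∀

∏-const : ∀ t (b : ℤ) → ∏ t (const b) ≡ b ^ t
∏-const zero    b = refl
∏-const (suc t) b = cong (b *_) (∏-const t b)

∂∏-zeroDirection : ∀ t (β : Fin t → ℤ) → ∂∏ t β (const 0ℤ) ≡ 0ℤ
∂∏-zeroDirection zero    β = refl
∂∏-zeroDirection (suc t) β =
  trans (cong (λ z → β zero * z + 0ℤ * ∏ t (β ∘ suc)) (∂∏-zeroDirection t (β ∘ suc)))
        (trans (cong (_+ 0ℤ * ∏ t (β ∘ suc)) (ℤ.*-zeroʳ (β zero))) (ℤ.*-zeroˡ (∏ t (β ∘ suc))))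

partProd-absent : ∀ {t} N (p : Fin N → Fin t) d P → (∀ u → p u ≢ P) → partProd N p d P ≡ 1ℤ
partProd-absent zero    p d P absent = refl
partProd-absent (suc N) p d P absent =
  trans (partProd-insertElsewhere p d zero P (absent zero)) (partProd-absent N (p ∘ suc) (d ∘ suc) P (absent ∘ suc))

partDeriv-absent : ∀ {t} N (p : Fin N → Fin t) d P → (∀ u → p u ≢ P) → partDeriv N p d P ≡ 0ℤ
partDeriv-absent zero    p d P absent = refl
partDeriv-absent (suc N) p d P absent =
  trans (partDeriv-insertElsewhere p d zero P (absent zero)) (partDeriv-absent N (p ∘ suc) (d ∘ suc) P (absent ∘ suc))

DetFormula : ℕ → ℕ → Set
DetFormula N t = ∀ x (p : Fin N → Fin t) d →
  det N (partMatrix x p d) ≡ partDet x t (blockDet N p d) (partDeriv N p d)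

detFormula-sharedPart : ∀ {n t} x (p : Fin (suc (suc n)) → Fin (suc t)) d (w : Fin (suc n)) →
  d zero ≡ 0ℤ → p (suc w) ≡ p zero → DetFormula (suc n) (suc t) →
  det (suc (suc n)) (partMatrix x p d) ≡ partDet x (suc t) (blockDet (suc (suc n)) p d) (partDeriv (suc (suc n)) p d)
detFormula-sharedPart {n} {t} x p d w d₀≡0 same formula = begin
  det (suc (suc n)) (partMatrix x p d)                   ≡⟨ det-partMatrix-sharedPart x p d w d₀≡0 same ⟩
  d (suc w) * det (suc n) (partMatrix x p′ d′)            ≡⟨ cong (d (suc w) *_) (formula x p′ d′) ⟩
  d (suc w) * Ψ′                                          ≡⟨ ℤ.+-identityʳ (d (suc w) * Ψ′) ⟨
  d (suc w) * Ψ′ + 0ℤ                                     ≡⟨ cong (_+_ (d (suc w) * Ψ′)) (trans (ℤ.*-zeroˡ K) (cong (_* K) (sym π′≡0))) ⟩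
  d (suc w) * Ψ′ + partProd (suc n) p′ d′ (p (suc w)) * K  ≡⟨ partDet-insert x p d (suc w) ⟨
  partDet x (suc t) (blockDet (suc (suc n)) p d) (partDeriv (suc (suc n)) p d)  ∎
  where
  p′ = p ∘ punchIn (suc w)
  d′ = d ∘ punchIn (suc w)
  Ψ′ = partDet x (suc t) (blockDet (suc n) p′ d′) (partDeriv (suc n) p′ d′)
  K  = partDet₀ x t (blockDet (suc n) p′ d′) (partDeriv (suc n) p′ d′) (p (suc w))
  Π′ = ∏ n (partDiag p′ d′ (p (suc w)) ∘ suc)
  -- vertex 0, of weight 0, lies in this part
  π′≡0 : partProd (suc n) p′ d′ (p (suc w)) ≡ 0ℤ
  π′≡0 = trans (cong (λ b → (if b then d zero else 1ℤ) * Π′) (trans (cong (p zero ==ᶠ_) same) (==ᶠ-refl (p zero))))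
               (trans (cong (_* Π′) d₀≡0) (ℤ.*-zeroˡ Π′))

detFormula-isolated : ∀ {N t} x (p : Fin (suc N) → Fin (suc t)) d →
  d zero ≡ 0ℤ → (∀ w → p (suc w) ≢ p zero) → DetFormula N (suc t) →
  det (suc N) (partMatrix x p d) ≡ partDet x (suc t) (blockDet (suc N) p d) (partDeriv (suc N) p d)
detFormula-isolated {N} {t} x p d d₀≡0 isolated formula = begin
  det (suc N) (partMatrix x p d)
    ≡⟨ det-partMatrix-isolated x p d d₀≡0 isolated ⟩
  x * det N (partMatrix 0ℤ (p ∘ suc) (d ∘ suc)) - + 2 * det N (partMatrix x (p ∘ suc) (d ∘ suc))
    ≡⟨ cong₂ (λ y z → x * y - + 2 * z) (formula 0ℤ (p ∘ suc) (d ∘ suc)) (formula x (p ∘ suc) (d ∘ suc)) ⟩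
  x * partDet 0ℤ (suc t) β α - + 2 * partDet x (suc t) β α
    ≡⟨ cong₂ (λ y z → x * y - + 2 * z) (partDet-remove 0ℤ t (p zero) β α) (partDet-remove x t (p zero) β α) ⟩
  x * (β (p zero) * (C + 0ℤ * ∂) + 0ℤ * (α (p zero) * C)) - + 2 * (β (p zero) * B + x * (α (p zero) * C))
    ≡⟨ cong₂ (λ b a → x * (b * (C + 0ℤ * ∂) + 0ℤ * (a * C)) - + 2 * (b * B + x * (a * C))) β≡1 α≡0 ⟩
  x * (1ℤ * (C + 0ℤ * ∂) + 0ℤ * (0ℤ * C)) - + 2 * (1ℤ * B + x * (0ℤ * C))
    ≡⟨ simplify x B C ∂ (partDet x (suc t) β α) ⟩
  0ℤ * partDet x (suc t) β α + 1ℤ * partDet₀ x t β α (p zero)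
    ≡⟨ cong₂ (λ y z → y * partDet x (suc t) β α + z * partDet₀ x t β α (p zero)) d₀≡0 π≡1 ⟨
  d zero * partDet x (suc t) β α + partProd N (p ∘ suc) (d ∘ suc) (p zero) * partDet₀ x t β α (p zero)
    ≡⟨ partDet-insert x p d zero ⟨
  partDet x (suc t) (blockDet (suc N) p d) (partDeriv (suc N) p d)  ∎
  where
  β = blockDet N (p ∘ suc) (d ∘ suc)
  α = partDeriv N (p ∘ suc) (d ∘ suc)
  B = partDet x t (β ∘ punchIn (p zero)) (α ∘ punchIn (p zero))
  C = ∏ t (β ∘ punchIn (p zero))
  ∂ = ∂∏ t (β ∘ punchIn (p zero)) (α ∘ punchIn (p zero))
  π≡1 : partProd N (p ∘ suc) (d ∘ suc) (p zero) ≡ 1ℤ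
  π≡1 = partProd-absent N (p ∘ suc) (d ∘ suc) (p zero) isolated
  α≡0 : α (p zero) ≡ 0ℤ
  α≡0 = partDeriv-absent N (p ∘ suc) (d ∘ suc) (p zero) isolated
  β≡1 : β (p zero) ≡ 1ℤ
  β≡1 = cong₂ (λ y z → y - + 2 * z) π≡1 α≡0
  simplify : ∀ (x B C ∂ R : ℤ) →
    x * (1ℤ * (C + 0ℤ * ∂) + 0ℤ * (0ℤ * C)) - + 2 * (1ℤ * B + x * (0ℤ * C)) ≡ 0ℤ * R + 1ℤ * (x * C - + 2 * B)
  simplify = solve-∀

detFormula-zeroWeight₀ : ∀ {N t} x (p : Fin (suc N) → Fin (suc t)) d → d zero ≡ 0ℤ → DetFormula N (suc t) →
  det (suc N) (partMatrix x p d) ≡ partDet x (suc t) (blockDet (suc N) p d) (partDeriv (suc N) p d)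
detFormula-zeroWeight₀ {zero}  x p d d₀≡0 formula = detFormula-isolated x p d d₀≡0 (λ ()) formula
detFormula-zeroWeight₀ {suc n} x p d d₀≡0 formula with any? (λ w → p (suc w) ≟ p zero)
... | yes (w , same) = detFormula-sharedPart x p d w d₀≡0 same formula
... | no  isolated   = detFormula-isolated x p d d₀≡0 (λ w same → isolated (w , same)) formula

det-partMatrix : ∀ N t → DetFormula N t
det-partMatrix zero    t       x p d = sym (begin
  ∏ t (const 1ℤ) + x * ∂∏ t (const 1ℤ) (const 0ℤ)
    ≡⟨ cong₂ (λ y z → y + x * z) (∏-const t 1ℤ) (∂∏-zeroDirection t (const 1ℤ)) ⟩
  1ℤ ^ t + x * 0ℤ                                  ≡⟨ cong₂ _+_ (ℤ.^-zeroˡ t) (ℤ.*-zeroʳ x) ⟩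
  1ℤ                                               ∎)
det-partMatrix (suc N) zero    x p d with p zero
... | ()
det-partMatrix (suc N) (suc t) x p d = begin
  det (suc N) (partMatrix x p d)
    ≡⟨ det-partMatrix-splitDiag₀ x p d ⟩
  det (suc N) (partMatrix x p d₀) + d zero * det N (partMatrix x (p ∘ suc) (d ∘ suc))
    ≡⟨ cong₂ (λ y z → y + d zero * z)
         (detFormula-zeroWeight₀ x p d₀ refl (det-partMatrix N (suc t))) (det-partMatrix N (suc t) x (p ∘ suc) (d ∘ suc)) ⟩
  partDet x (suc t) (blockDet (suc N) p d₀) (partDeriv (suc N) p d₀) + d zero * R
    ≡⟨ cong (_+ d zero * R) (partDet-insert x p d₀ zero) ⟩
  (0ℤ * R + Y) + d zero * R
    ≡⟨ regroup (d zero) R Y ⟩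
  d zero * R + Y
    ≡⟨ partDet-insert x p d zero ⟨
  partDet x (suc t) (blockDet (suc N) p d) (partDeriv (suc N) p d)  ∎
  where
  d₀ = updateAt d zero (const 0ℤ)
  R  = partDet x (suc t) (blockDet N (p ∘ suc) (d ∘ suc)) (partDeriv N (p ∘ suc) (d ∘ suc))
  Y  = partProd N (p ∘ suc) (d ∘ suc) (p zero)
       * partDet₀ x t (blockDet N (p ∘ suc) (d ∘ suc)) (partDeriv N (p ∘ suc) (d ∘ suc)) (p zero)
  regroup : ∀ (e R Y : ℤ) → (0ℤ * R + Y) + e * R ≡ e * R + Y
  regroup = solve-∀

-- Constant weights

count : ∀ {t} N → (Fin N → Fin t) → Fin t → ℕ
count N p P = ∑ℕ N (λ u → if p u ==ᶠ P then 1 else 0)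

partProd-const : ∀ {t} N (p : Fin N → Fin t) a P → partProd N p (const a) P ≡ a ^ count N p P
partProd-const zero    p a P = refl
partProd-const (suc N) p a P =
  trans (cong (partDiag p (const a) P zero *_) (partProd-const N (p ∘ suc) a P)) (withVertex₀ (p zero ==ᶠ P))
  where
  withVertex₀ : ∀ b → (if b then a else 1ℤ) * a ^ count N (p ∘ suc) P ≡ a ^ ((if b then 1 else 0) ℕ.+ count N (p ∘ suc) P)
  withVertex₀ true  = refl
  withVertex₀ false = ℤ.*-identityˡ _

partDeriv-const : ∀ {t} N (p : Fin N → Fin t) a P →
  partDeriv N p (const a) P ≡ + count N p P * a ^ (count N p P ∸ 1)
partDeriv-const zero    p a P = refl
partDeriv-const (suc N) p a P =
  trans (cong₂ (λ y z → partDiag p (const a) P zero * y + δ (p zero) P * z)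
               (partDeriv-const N (p ∘ suc) a P) (partProd-const N (p ∘ suc) a P))
        (withVertex₀ (p zero ==ᶠ P) (count N (p ∘ suc) P))
  where
  withVertex₀ : ∀ b c → (if b then a else 1ℤ) * (+ c * a ^ (c ∸ 1)) + (if b then 1ℤ else 0ℤ) * a ^ c
                   ≡ + ((if b then 1 else 0) ℕ.+ c) * a ^ ((if b then 1 else 0) ℕ.+ c ∸ 1)
  withVertex₀ false c       = simplify (+ c * a ^ (c ∸ 1)) (a ^ c)
    where
    simplify : ∀ (y z : ℤ) → 1ℤ * y + 0ℤ * z ≡ y
    simplify = solve-∀
  withVertex₀ true  zero    = simplify a
    where
    simplify : ∀ (a : ℤ) → a * (0ℤ * 1ℤ) + 1ℤ * 1ℤ ≡ 1ℤ * 1ℤ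
    simplify = solve-∀
  withVertex₀ true  (suc c) = simplify a (a ^ c) (+ suc c)
    where
    simplify : ∀ (a y m : ℤ) → a * (m * y) + 1ℤ * (a * y) ≡ (1ℤ + m) * (a * y)
    simplify = solve-∀

blockDet-const : ∀ {t} N (p : Fin N → Fin t) a P → 1 ℕ.≤ count N p P →
  blockDet N p (const a) P ≡ a ^ (count N p P ∸ 1) * (a - + 2 * + count N p P)
blockDet-const N p a P c≥1 =
  trans (cong₂ (λ y z → y - + 2 * z) (partProd-const N p a P) (partDeriv-const N p a P)) (factor (count N p P) c≥1)
  where
  factor : ∀ c → 1 ℕ.≤ c → a ^ c - + 2 * (+ c * a ^ (c ∸ 1)) ≡ a ^ (c ∸ 1) * (a - + 2 * + c)
  factor (suc c) _ = regroup a (a ^ c) (+ suc c)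
    where
    regroup : ∀ (a y m : ℤ) → a * y - + 2 * (m * y) ≡ y * (a - + 2 * m)
    regroup = solve-∀

-- Enumerating parts and vertices

∑ℕ-cong : ∀ m {f g : Fin m → ℕ} → (∀ i → f i ≡ g i) → ∑ℕ m f ≡ ∑ℕ m g
∑ℕ-cong zero    f≗g = refl
∑ℕ-cong (suc m) f≗g = cong₂ ℕ._+_ (f≗g zero) (∑ℕ-cong m (f≗g ∘ suc))

∑ℕ-const : ∀ m v → ∑ℕ m (const v) ≡ m ℕ.* v
∑ℕ-const zero    v = refl
∑ℕ-const (suc m) v = cong (v ℕ.+_) (∑ℕ-const m v)

∑ℕ-splitAt : ∀ m n (F : Fin m ⊎ Fin n → ℕ) →
  ∑ℕ (m ℕ.+ n) (F ∘ splitAt m) ≡ ∑ℕ m (F ∘ inj₁) ℕ.+ ∑ℕ n (F ∘ inj₂)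
∑ℕ-splitAt zero    n F = refl
∑ℕ-splitAt (suc m) n F =
  trans (cong (F (inj₁ zero) ℕ.+_) (∑ℕ-splitAt m n (F ∘ map₁ suc))) (sym (ℕₚ.+-assoc (F (inj₁ zero)) _ _))

∑ℕ-select : ∀ m (g : Fin m → ℕ) Q → ∑ℕ m (λ i → g i ℕ.* (if i ==ᶠ Q then 1 else 0)) ≡ g Q
∑ℕ-select (suc m) g zero =
  trans (cong₂ ℕ._+_ (ℕₚ.*-identityʳ (g zero)) (∑ℕ-cong m (λ i → ℕₚ.*-zeroʳ (g (suc i)))))
        (trans (cong (g zero ℕ.+_) (∑ℕ-const m 0)) (trans (cong (g zero ℕ.+_) (ℕₚ.*-zeroʳ m)) (ℕₚ.+-identityʳ (g zero))))
∑ℕ-select (suc m) g (suc Q) =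
  trans (cong (ℕ._+ ∑ℕ m (λ i → g (suc i) ℕ.* (if i ==ᶠ Q then 1 else 0))) (ℕₚ.*-zeroʳ (g zero)))
        (∑ℕ-select m (g ∘ suc) Q)

enumΣ : ∀ s (m : Fin s → ℕ) → Fin (∑ℕ s m) → Σ (Fin s) (Fin ∘ m)

enumΣ-split : ∀ {s} (m : Fin (suc s) → ℕ) → Fin (m zero) ⊎ Fin (∑ℕ s (m ∘ suc)) → Σ (Fin (suc s)) (Fin ∘ m)
enumΣ-split m (inj₁ c) = zero , c
enumΣ-split m (inj₂ q) = suc (proj₁ (enumΣ _ (m ∘ suc) q)) , proj₂ (enumΣ _ (m ∘ suc) q)

enumΣ (suc s) m Q = enumΣ-split m (splitAt (m zero) Q)

indexΣ : ∀ s (m : Fin s → ℕ) → Σ (Fin s) (Fin ∘ m) → Fin (∑ℕ s m)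
indexΣ (suc s) m (zero  , c) = c ↑ˡ ∑ℕ s (m ∘ suc)
indexΣ (suc s) m (suc i , c) = m zero ↑ʳ indexΣ s (m ∘ suc) (i , c)

enumΣ-indexΣ : ∀ s m (x : Σ (Fin s) (Fin ∘ m)) → enumΣ s m (indexΣ s m x) ≡ x
enumΣ-indexΣ (suc s) m (zero , c)
  rewrite splitAt-↑ˡ (m zero) c (∑ℕ s (m ∘ suc)) = refl
enumΣ-indexΣ (suc s) m (suc i , c)
  rewrite splitAt-↑ʳ (m zero) (∑ℕ s (m ∘ suc)) (indexΣ s (m ∘ suc) (i , c)) | enumΣ-indexΣ s (m ∘ suc) (i , c) = refl

indexΣ-enumΣ : ∀ s m (Q : Fin (∑ℕ s m)) → indexΣ s m (enumΣ s m Q) ≡ Q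
indexΣ-enumΣ (suc s) m Q with splitAt (m zero) Q in eq
... | inj₁ c = splitAt⁻¹-↑ˡ eq
... | inj₂ q = trans (cong (m zero ↑ʳ_) (indexΣ-enumΣ s (m ∘ suc) q)) (splitAt⁻¹-↑ʳ eq)

∑ℕ-enumΣ : ∀ s m (h : Σ (Fin s) (Fin ∘ m) → ℕ) →
  ∑ℕ (∑ℕ s m) (h ∘ enumΣ s m) ≡ ∑ℕ s (λ i → ∑ℕ (m i) (λ c → h (i , c)))
∑ℕ-enumΣ zero    m h = refl
∑ℕ-enumΣ (suc s) m h =
  trans (∑ℕ-splitAt (m zero) (∑ℕ s (m ∘ suc)) (h ∘ enumΣ-split m))
        (cong (∑ℕ (m zero) (λ c → h (zero , c)) ℕ.+_) (∑ℕ-enumΣ s (m ∘ suc) (λ x → h (suc (proj₁ x) , proj₂ x))))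

module ℕSum = CommutativeMonoidSum ℕₚ.+-0-commutativeMonoid
module ℕ+ = CommutativeSemigroupProperties ℕₚ.+-commutativeSemigroup

∑ℕ≡sum : ∀ m (f : Fin m → ℕ) → ∑ℕ m f ≡ ℕSum.sum f
∑ℕ≡sum zero    f = refl
∑ℕ≡sum (suc m) f = cong (f zero ℕ.+_) (∑ℕ≡sum m (f ∘ suc))

∑ℕ-permute : ∀ {m n} (π : Fin m ↔ Fin n) (f : Fin n → ℕ) → ∑ℕ n f ≡ ∑ℕ m (f ∘ Inverse.to π)
∑ℕ-permute {m} {n} π f = trans (∑ℕ≡sum n f) (trans (ℕSum.sum-permute f π) (sym (∑ℕ≡sum m (f ∘ Inverse.to π))))

module _ (s : ℕ) (n r : Fin s → ℕ) where

  partOf : MVert s n r → Σ (Fin s) (Fin ∘ r)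
  partOf (i , c , _) = i , c

  vertexCount : ℕ
  vertexCount = ∑ℕ s (λ i → ∑ℕ (r i) (const (n i)))

  vertexOf : Fin vertexCount → MVert s n r
  vertexOf R = map₂ (λ {i} → enumΣ (r i) (const (n i))) (enumΣ s (λ i → ∑ℕ (r i) (const (n i))) R)

  vertexIndex : MVert s n r → Fin vertexCount
  vertexIndex (i , ce) = indexΣ s (λ i → ∑ℕ (r i) (const (n i))) (i , indexΣ (r i) (const (n i)) ce)

  vertexOf-vertexIndex : ∀ v → vertexOf (vertexIndex v) ≡ v
  vertexOf-vertexIndex (i , ce) =
    trans (cong (map₂ (λ {i} → enumΣ (r i) (const (n i)))) (enumΣ-indexΣ s _ (i , indexΣ (r i) (const (n i)) ce)))
          (cong (i ,_) (enumΣ-indexΣ (r i) (const (n i)) ce))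

  vertexIndex-vertexOf : ∀ R → vertexIndex (vertexOf R) ≡ R
  vertexIndex-vertexOf R =
    trans (cong (λ ce → indexΣ s _ (proj₁ x , ce)) (indexΣ-enumΣ (r (proj₁ x)) (const (n (proj₁ x))) (proj₂ x)))
          (indexΣ-enumΣ s _ R)
    where
    x = enumΣ s (λ i → ∑ℕ (r i) (const (n i))) R

  ∑ℕ-vertexOf : (h : MVert s n r → ℕ) →
    ∑ℕ vertexCount (h ∘ vertexOf) ≡ ∑ℕ s (λ i → ∑ℕ (r i) (λ c → ∑ℕ (n i) (λ e → h (i , c , e))))
  ∑ℕ-vertexOf h = trans (∑ℕ-enumΣ s _ (λ x → h (map₂ (λ {i} → enumΣ (r i) (const (n i))) x)))
                        (∑ℕ-cong s (λ i → ∑ℕ-enumΣ (r i) (const (n i)) (λ ce → h (i , ce))))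

  module _ {N} (lab : Fin N ↔ MVert s n r) where

    labelledPart : Fin N → Fin (∑ℕ s r)
    labelledPart u = indexΣ s r (partOf (Inverse.to lab u))

    count-labelledPart : ∀ Q → count N labelledPart Q ≡ n (proj₁ (enumΣ s r Q))
    count-labelledPart Q = begin
      ∑ℕ N (λ u → [ labelledPart u ]== Q)
        ≡⟨ ∑ℕ-permute relabel (λ u → [ labelledPart u ]== Q) ⟩
      ∑ℕ vertexCount (λ R → [ indexΣ s r (partOf (Inverse.to lab (Inverse.from lab (vertexOf R)))) ]== Q)
        ≡⟨ ∑ℕ-cong vertexCount (λ R →
             cong (λ v → [ indexΣ s r (partOf v) ]== Q) (Inverse.strictlyInverseˡ lab (vertexOf R))) ⟩
      ∑ℕ vertexCount (λ R → [ indexΣ s r (partOf (vertexOf R)) ]== Q)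
        ≡⟨ ∑ℕ-vertexOf (λ v → [ indexΣ s r (partOf v) ]== Q) ⟩
      ∑ℕ s (λ i → ∑ℕ (r i) (λ c → ∑ℕ (n i) (const ([ indexΣ s r (i , c) ]== Q))))
        ≡⟨ ∑ℕ-cong s (λ i → ∑ℕ-cong (r i) (λ c → ∑ℕ-const (n i) ([ indexΣ s r (i , c) ]== Q))) ⟩
      ∑ℕ s (λ i → ∑ℕ (r i) (λ c → n i ℕ.* [ indexΣ s r (i , c) ]== Q))
        ≡⟨ ∑ℕ-enumΣ s r (λ x → n (proj₁ x) ℕ.* [ indexΣ s r x ]== Q) ⟨
      ∑ℕ (∑ℕ s r) (λ Q′ → n (proj₁ (enumΣ s r Q′)) ℕ.* [ indexΣ s r (enumΣ s r Q′) ]== Q)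
        ≡⟨ ∑ℕ-cong (∑ℕ s r) (λ Q′ →
             cong (λ z → n (proj₁ (enumΣ s r Q′)) ℕ.* [ z ]== Q) (indexΣ-enumΣ s r Q′)) ⟩
      ∑ℕ (∑ℕ s r) (λ Q′ → n (proj₁ (enumΣ s r Q′)) ℕ.* [ Q′ ]== Q)
        ≡⟨ ∑ℕ-select (∑ℕ s r) (n ∘ proj₁ ∘ enumΣ s r) Q ⟩
      n (proj₁ (enumΣ s r Q))  ∎
      where
      [_]==_ : Fin (∑ℕ s r) → Fin (∑ℕ s r) → ℕ
      [ P ]== Q = if P ==ᶠ Q then 1 else 0
      relabel : Fin vertexCount ↔ Fin N
      relabel = mk↔ₛ′ (Inverse.from lab ∘ vertexOf) (vertexIndex ∘ Inverse.to lab)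
        (λ u → trans (cong (Inverse.from lab) (vertexOf-vertexIndex (Inverse.to lab u))) (Inverse.strictlyInverseʳ lab u))
        (λ R → trans (cong vertexIndex (Inverse.strictlyInverseˡ lab (vertexOf R))) (vertexIndex-vertexOf R))

≡ᵇ-≢ : ∀ {a b} → a ≢ b → (a ℕ.≡ᵇ b) ≡ false
≡ᵇ-≢ {a} {b} = dec-false (a ℕ.≟ b)

≡ᵇ-+ : ∀ k a b → ((k ℕ.+ a) ℕ.≡ᵇ (k ℕ.+ b)) ≡ (a ℕ.≡ᵇ b)
≡ᵇ-+ zero    a b = refl
≡ᵇ-+ (suc k) a b = ≡ᵇ-+ k a b

indexΣ-==ᶠ : ∀ s (m : Fin s → ℕ) (i j : Fin s) (c : Fin (m i)) (e : Fin (m j)) →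
  (indexΣ s m (i , c) ==ᶠ indexΣ s m (j , e)) ≡ (i ==ᶠ j) ∧ (toℕ c ℕ.≡ᵇ toℕ e)
indexΣ-==ᶠ (suc s) m zero    zero    c e = cong₂ ℕ._≡ᵇ_ (toℕ-↑ˡ c _) (toℕ-↑ˡ e _)
indexΣ-==ᶠ (suc s) m zero    (suc j) c e =
  trans (cong₂ ℕ._≡ᵇ_ (toℕ-↑ˡ c _) (toℕ-↑ʳ (m zero) (indexΣ s (m ∘ suc) (j , e))))
        (≡ᵇ-≢ (ℕₚ.<⇒≢ (ℕₚ.<-≤-trans (toℕ<n c) (ℕₚ.m≤m+n (m zero) _))))
indexΣ-==ᶠ (suc s) m (suc i) zero    c e =
  trans (cong₂ ℕ._≡ᵇ_ (toℕ-↑ʳ (m zero) (indexΣ s (m ∘ suc) (i , c))) (toℕ-↑ˡ e _))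
        (≡ᵇ-≢ (ℕₚ.<⇒≢ (ℕₚ.<-≤-trans (toℕ<n e) (ℕₚ.m≤m+n (m zero) _)) ∘ sym))
indexΣ-==ᶠ (suc s) m (suc i) (suc j) c e =
  trans (cong₂ ℕ._≡ᵇ_ (toℕ-↑ʳ (m zero) (indexΣ s (m ∘ suc) (i , c))) (toℕ-↑ʳ (m zero) (indexΣ s (m ∘ suc) (j , e))))
        (trans (≡ᵇ-+ (m zero) _ _) (indexΣ-==ᶠ s (m ∘ suc) i j c e))

samePart-indexΣ : ∀ {s} {n r : Fin s → ℕ} (v w : MVert s n r) →
  samePart v w ≡ (indexΣ s r (partOf s n r v) ==ᶠ indexΣ s r (partOf s n r w))
samePart-indexΣ {s} {r = r} (i , c , _) (j , e , _) = sym (indexΣ-==ᶠ s r i j c e)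

-- Grouping equal parts

∏-splitAt : ∀ m n (F : Fin m ⊎ Fin n → ℤ) → ∏ (m ℕ.+ n) (F ∘ splitAt m) ≡ ∏ m (F ∘ inj₁) * ∏ n (F ∘ inj₂)
∏-splitAt zero    n F = sym (ℤ.*-identityˡ _)
∏-splitAt (suc m) n F =
  trans (cong (F (inj₁ zero) *_) (∏-splitAt m n (F ∘ map₁ suc))) (sym (ℤ.*-assoc (F (inj₁ zero)) _ _))

∂∏-splitAt : ∀ m n (F H : Fin m ⊎ Fin n → ℤ) →
  ∂∏ (m ℕ.+ n) (F ∘ splitAt m) (H ∘ splitAt m)
    ≡ ∂∏ m (F ∘ inj₁) (H ∘ inj₁) * ∏ n (F ∘ inj₂) + ∏ m (F ∘ inj₁) * ∂∏ n (F ∘ inj₂) (H ∘ inj₂)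
∂∏-splitAt zero    n F H = simplify (∏ n (F ∘ inj₂)) (∂∏ n (F ∘ inj₂) (H ∘ inj₂))
  where
  simplify : ∀ (P D : ℤ) → D ≡ 0ℤ * P + 1ℤ * D
  simplify = solve-∀
∂∏-splitAt (suc m) n F H = begin
  F₀ * ∂∏ (m ℕ.+ n) (F ∘ map₁ suc ∘ splitAt m) (H ∘ map₁ suc ∘ splitAt m) + H₀ * ∏ (m ℕ.+ n) (F ∘ map₁ suc ∘ splitAt m)
    ≡⟨ cong₂ (λ y z → F₀ * y + H₀ * z)
         (∂∏-splitAt m n (F ∘ map₁ suc) (H ∘ map₁ suc)) (∏-splitAt m n (F ∘ map₁ suc)) ⟩
  F₀ * (∂ₘ * Πₙ + Πₘ * ∂ₙ) + H₀ * (Πₘ * Πₙ)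
    ≡⟨ leibniz F₀ H₀ ∂ₘ Πₙ Πₘ ∂ₙ ⟩
  (F₀ * ∂ₘ + H₀ * Πₘ) * Πₙ + (F₀ * Πₘ) * ∂ₙ  ∎
  where
  F₀ = F (inj₁ zero)
  H₀ = H (inj₁ zero)
  ∂ₘ = ∂∏ m (F ∘ inj₁ ∘ suc) (H ∘ inj₁ ∘ suc)
  Πₘ = ∏ m (F ∘ inj₁ ∘ suc)
  ∂ₙ = ∂∏ n (F ∘ inj₂) (H ∘ inj₂)
  Πₙ = ∏ n (F ∘ inj₂)
  leibniz : ∀ (f h ∂ₘ Πₙ Πₘ ∂ₙ : ℤ) →
    f * (∂ₘ * Πₙ + Πₘ * ∂ₙ) + h * (Πₘ * Πₙ) ≡ (f * ∂ₘ + h * Πₘ) * Πₙ + (f * Πₘ) * ∂ₙ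
  leibniz = solve-∀

∂∏-const : ∀ r (b a : ℤ) → ∂∏ r (const b) (const a) ≡ + r * (a * b ^ (r ∸ 1))
∂∏-const zero          b a = refl
∂∏-const (suc zero)    b a = simplify b a
  where
  simplify : ∀ (b a : ℤ) → b * 0ℤ + a * 1ℤ ≡ + 1 * (a * 1ℤ)
  simplify = solve-∀
∂∏-const (suc (suc r)) b a =
  trans (cong₂ (λ y z → b * y + a * z) (∂∏-const (suc r) b a) (∏-const (suc r) b))
        (regroup b a (b ^ r) (+ suc r))
  where
  regroup : ∀ (b a y m : ℤ) → b * (m * (a * y)) + a * (b * y) ≡ (1ℤ + m) * (a * (b * y))
  regroup = solve-∀

∏-pow-pred : ∀ s (g : Fin s → ℤ) (r : Fin s → ℕ) → (∀ i → 1 ℕ.≤ r i) →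
  ∏ s (λ i → g i ^ r i) ≡ ∏ s (λ i → g i ^ (r i ∸ 1)) * ∏ s g
∏-pow-pred zero    g r r≥1 = refl
∏-pow-pred (suc s) g r r≥1 with r zero | r≥1 zero
... | suc r₀ | _ = trans (cong (g zero * g zero ^ r₀ *_) (∏-pow-pred s (g ∘ suc) (r ∘ suc) (r≥1 ∘ suc)))
                         (interchange (g zero) (g zero ^ r₀) (∏ s (λ i → g (suc i) ^ (r (suc i) ∸ 1))) (∏ s (g ∘ suc)))
  where
  interchange : ∀ (g y P Q : ℤ) → (g * y) * (P * Q) ≡ (y * P) * (g * Q)
  interchange = solve-∀

^-pred : ∀ (b : ℤ) {m} → 1 ℕ.≤ m → b ^ m ≡ b * b ^ (m ∸ 1)
^-pred b {suc m} _ = refl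

∑-pull : ∀ m (c : ℤ) (f g : Fin m → ℤ) → ∑ m (λ i → f i * (c * g i)) ≡ c * ∑ m (λ i → f i * g i)
∑-pull m c f g = trans (∑-cong m (λ i → swap (f i) c (g i))) (sym (*-distribˡ-∑ m c (λ i → f i * g i)))
  where
  swap : ∀ (a c b : ℤ) → a * (c * b) ≡ c * (a * b)
  swap = solve-∀

∏-enumΣ : ∀ s (r : Fin s → ℕ) (g : Fin s → ℤ) →
  ∏ (∑ℕ s r) (g ∘ proj₁ ∘ enumΣ s r) ≡ ∏ s (λ i → g i ^ r i)
∏-enumΣ zero    r g = refl
∏-enumΣ (suc s) r g =
  trans (∏-splitAt (r zero) (∑ℕ s (r ∘ suc)) (g ∘ proj₁ ∘ enumΣ-split r))
        (cong₂ _*_ (∏-const (r zero) (g zero)) (∏-enumΣ s (r ∘ suc) (g ∘ suc)))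

∂∏-enumΣ : ∀ s (r : Fin s → ℕ) (g h : Fin s → ℤ) → (∀ i → 1 ℕ.≤ r i) →
  ∂∏ (∑ℕ s r) (g ∘ proj₁ ∘ enumΣ s r) (h ∘ proj₁ ∘ enumΣ s r)
    ≡ ∏ s (λ i → g i ^ (r i ∸ 1)) * ∑ s (λ i → (+ r i * h i) * ∏≠ s i g)
∂∏-enumΣ zero    r g h r≥1 = refl
∂∏-enumΣ (suc s) r g h r≥1 = begin
  ∂∏ (r zero ℕ.+ K) (G ∘ splitAt (r zero)) (H ∘ splitAt (r zero))
    ≡⟨ ∂∏-splitAt (r zero) K G H ⟩
  ∂∏ (r zero) (const (g zero)) (const (h zero)) * ∏ K (G ∘ inj₂)
    + ∏ (r zero) (const (g zero)) * ∂∏ K (G ∘ inj₂) (H ∘ inj₂)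
    ≡⟨ cong₂ (λ y z → y * ∏ K (G ∘ inj₂) + z * ∂∏ K (G ∘ inj₂) (H ∘ inj₂))
         (∂∏-const (r zero) (g zero) (h zero)) (∏-const (r zero) (g zero)) ⟩
  + r zero * (h zero * g₀′) * ∏ K (G ∘ inj₂) + g zero ^ r zero * ∂∏ K (G ∘ inj₂) (H ∘ inj₂)
    ≡⟨ cong₂ (λ y z → + r zero * (h zero * g₀′) * y + g zero ^ r zero * z)
         (trans (∏-enumΣ s (r ∘ suc) (g ∘ suc)) (∏-pow-pred s (g ∘ suc) (r ∘ suc) (r≥1 ∘ suc)))
         (∂∏-enumΣ s (r ∘ suc) (g ∘ suc) (h ∘ suc) (r≥1 ∘ suc)) ⟩
  + r zero * (h zero * g₀′) * (F′ * Π′) + g zero ^ r zero * (F′ * Σ′)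
    ≡⟨ cong (λ y → + r zero * (h zero * g₀′) * (F′ * Π′) + y * (F′ * Σ′)) (^-pred (g zero) (r≥1 zero)) ⟩
  + r zero * (h zero * g₀′) * (F′ * Π′) + g zero * g₀′ * (F′ * Σ′)
    ≡⟨ regroup (+ r zero) (h zero) (g zero) g₀′ F′ Π′ Σ′ ⟩
  (g₀′ * F′) * ((+ r zero * h zero) * (1ℤ * Π′) + g zero * Σ′)
    ≡⟨ cong (λ y → (g₀′ * F′) * ((+ r zero * h zero) * (1ℤ * Π′) + y))
         (∑-pull s (g zero) (λ i → + r (suc i) * h (suc i)) (λ i → ∏≠ s i (g ∘ suc))) ⟨
  ∏ (suc s) (λ i → g i ^ (r i ∸ 1)) * ∑ (suc s) (λ i → (+ r i * h i) * ∏≠ (suc s) i g)  ∎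
  where
  K  = ∑ℕ s (r ∘ suc)
  G H : Fin (r zero) ⊎ Fin K → ℤ
  G = g ∘ proj₁ ∘ enumΣ-split r
  H = h ∘ proj₁ ∘ enumΣ-split r
  g₀′ = g zero ^ (r zero ∸ 1)
  F′ = ∏ s (λ i → g (suc i) ^ (r (suc i) ∸ 1))
  Π′ = ∏ s (g ∘ suc)
  Σ′ = ∑ s (λ i → (+ r (suc i) * h (suc i)) * ∏≠ s i (g ∘ suc))
  regroup : ∀ (r h g g′ F Π Σ : ℤ) →
    r * (h * g′) * (F * Π) + g * g′ * (F * Σ) ≡ (g′ * F) * ((r * h) * (1ℤ * Π) + g * Σ)
  regroup = solve-∀

partDet-enumΣ : ∀ x s (r : Fin s → ℕ) (g h : Fin s → ℤ) → (∀ i → 1 ℕ.≤ r i) →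
  partDet x (∑ℕ s r) (g ∘ proj₁ ∘ enumΣ s r) (h ∘ proj₁ ∘ enumΣ s r)
    ≡ ∏ s (λ i → g i ^ (r i ∸ 1)) * (∏ s g + x * ∑ s (λ i → (+ r i * h i) * ∏≠ s i g))
partDet-enumΣ x s r g h r≥1 =
  trans (cong₂ (λ y z → y + x * z) (trans (∏-enumΣ s r g) (∏-pow-pred s g r r≥1)) (∂∏-enumΣ s r g h r≥1))
        (factor x (∏ s (λ i → g i ^ (r i ∸ 1))) (∏ s g) (∑ s (λ i → (+ r i * h i) * ∏≠ s i g)))
  where
  factor : ∀ (x F Π Σ : ℤ) → F * Π + x * (F * Σ) ≡ F * (Π + x * Σ)
  factor = solve-∀

∏-distrib-* : ∀ t (e g : Fin t → ℤ) → ∏ t (λ i → e i * g i) ≡ ∏ t e * ∏ t g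
∏-distrib-* zero    e g = refl
∏-distrib-* (suc t) e g =
  trans (cong (e zero * g zero *_) (∏-distrib-* t (e ∘ suc) (g ∘ suc)))
        (interchange (e zero) (g zero) (∏ t (e ∘ suc)) (∏ t (g ∘ suc)))
  where
  interchange : ∀ (a b c d : ℤ) → (a * b) * (c * d) ≡ (a * c) * (b * d)
  interchange = solve-∀

∂∏-scale : ∀ t (e g h : Fin t → ℤ) → ∂∏ t (λ i → e i * g i) (λ i → e i * h i) ≡ ∏ t e * ∂∏ t g h
∂∏-scale zero    e g h = refl
∂∏-scale (suc t) e g h = begin
  e zero * g zero * ∂∏ t (λ i → e (suc i) * g (suc i)) (λ i → e (suc i) * h (suc i))
    + e zero * h zero * ∏ t (λ i → e (suc i) * g (suc i))
    ≡⟨ cong₂ (λ y z → e zero * g zero * y + e zero * h zero * z)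
         (∂∏-scale t (e ∘ suc) (g ∘ suc) (h ∘ suc)) (∏-distrib-* t (e ∘ suc) (g ∘ suc)) ⟩
  e zero * g zero * (∏ t (e ∘ suc) * ∂∏ t (g ∘ suc) (h ∘ suc)) + e zero * h zero * (∏ t (e ∘ suc) * ∏ t (g ∘ suc))
    ≡⟨ factor (e zero) (g zero) (h zero) (∏ t (e ∘ suc)) (∂∏ t (g ∘ suc) (h ∘ suc)) (∏ t (g ∘ suc)) ⟩
  (e zero * ∏ t (e ∘ suc)) * (g zero * ∂∏ t (g ∘ suc) (h ∘ suc) + h zero * ∏ t (g ∘ suc))  ∎
  where
  factor : ∀ (e g h E D G : ℤ) → e * g * (E * D) + e * h * (E * G) ≡ (e * E) * (g * D + h * G)
  factor = solve-∀

partDet-scale : ∀ x t (e g h : Fin t → ℤ) → partDet x t (λ i → e i * g i) (λ i → e i * h i) ≡ ∏ t e * partDet x t g h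
partDet-scale x t e g h =
  trans (cong₂ (λ y z → y + x * z) (∏-distrib-* t e g) (∂∏-scale t e g h)) (factor x (∏ t e) (∏ t g) (∂∏ t g h))
  where
  factor : ∀ (x E G D : ℤ) → E * G + x * (E * D) ≡ E * (G + x * D)
  factor = solve-∀

∏-pow : ∀ s (a : ℤ) (g : Fin s → ℕ) → ∏ s (λ i → a ^ g i) ≡ a ^ ∑ℕ s g
∏-pow zero    a g = refl
∏-pow (suc s) a g = trans (cong (a ^ g zero *_) (∏-pow s a (g ∘ suc))) (sym (ℤ.^-distribˡ-+-* a (g zero) _))

∑ℕ-distrib-+ : ∀ s (f g : Fin s → ℕ) → ∑ℕ s (λ i → f i ℕ.+ g i) ≡ ∑ℕ s f ℕ.+ ∑ℕ s g
∑ℕ-distrib-+ zero    f g = refl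
∑ℕ-distrib-+ (suc s) f g =
  trans (cong (f zero ℕ.+ g zero ℕ.+_) (∑ℕ-distrib-+ s (f ∘ suc) (g ∘ suc)))
        (ℕ+.interchange (f zero) (g zero) (∑ℕ s (f ∘ suc)) (∑ℕ s (g ∘ suc)))

∏-enumΣ-pow : ∀ s (r n : Fin s → ℕ) (a : ℤ) → (∀ i → 1 ℕ.≤ n i) →
  ∏ (∑ℕ s r) (λ Q → a ^ (n (proj₁ (enumΣ s r Q)) ∸ 1)) ≡ a ^ (∑ℕ s (λ i → r i ℕ.* n i) ∸ ∑ℕ s r)
∏-enumΣ-pow s r n a n≥1 = begin
  ∏ (∑ℕ s r) (λ Q → a ^ (n (proj₁ (enumΣ s r Q)) ∸ 1))
    ≡⟨ ∏-enumΣ s r (λ i → a ^ (n i ∸ 1)) ⟩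
  ∏ s (λ i → (a ^ (n i ∸ 1)) ^ r i)
    ≡⟨ ∏-cong s (λ i → ℤ.^-*-assoc a (n i ∸ 1) (r i)) ⟩
  ∏ s (λ i → a ^ ((n i ∸ 1) ℕ.* r i))
    ≡⟨ ∏-pow s a (λ i → (n i ∸ 1) ℕ.* r i) ⟩
  a ^ ∑ℕ s (λ i → (n i ∸ 1) ℕ.* r i)
    ≡⟨ cong (a ^_) exponent ⟨
  a ^ (∑ℕ s (λ i → r i ℕ.* n i) ∸ ∑ℕ s r)  ∎
  where
  perVertex : ∀ i → r i ℕ.* n i ≡ (n i ∸ 1) ℕ.* r i ℕ.+ r i
  perVertex i with n i | n≥1 i
  ... | suc m | _ = trans (ℕₚ.*-comm (r i) (suc m)) (ℕₚ.+-comm (r i) (m ℕ.* r i))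
  exponent : ∑ℕ s (λ i → r i ℕ.* n i) ∸ ∑ℕ s r ≡ ∑ℕ s (λ i → (n i ∸ 1) ℕ.* r i)
  exponent = trans (cong (_∸ ∑ℕ s r) (trans (∑ℕ-cong s perVertex) (∑ℕ-distrib-+ s (λ i → (n i ∸ 1) ℕ.* r i) r)))
                   (ℕₚ.m+n∸n≡m (∑ℕ s (λ i → (n i ∸ 1) ℕ.* r i)) (∑ℕ s r))

seidelEntry : ∀ (b : Bool) (x d : ℤ) →
  x * d - (1ℤ - d - + 2 * (if (if b then false else true) then 1ℤ else 0ℤ))
    ≡ (x + 1ℤ) * d + (1ℤ - + 2 * (if b then 1ℤ else 0ℤ))
seidelEntry true  = solve-∀
seidelEntry false = solve-∀

corollary2p3 : (s : ℕ) (n r : Fin s → ℕ) →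
  Injective _≡_ _≡_ n →
  (∀ i → 1 ℕ.≤ n i) →
  (∀ i → 1 ℕ.≤ r i) →
  (N : ℕ) (lab : Fin N ↔ MVert s n r) →
  let G = completeMultipartite s n r lab
      k = ∑ℕ s r
      nn = ∑ℕ s (λ i → r i ℕ.* n i)
      f = λ (x : ℤ) (i : Fin s) → x + 1ℤ - (+ 2) * (+ n i)
  in (x : ℤ) →
    seidelCharPoly G x
      ≡ ((x + 1ℤ) ^ (nn ∸ k))
        * (∏ s (λ i → f x i ^ (r i ∸ 1))
        * (∏ s (λ i → f x i) + ∑ s (λ i → (+ (r i ℕ.* n i)) * ∏≠ s i (f x))))
corollary2p3 s n r _ n≥1 r≥1 N lab x = begin
  det N (λ u v → x * δ u v - seidel G u v)
    ≡⟨ det-cong N entry ⟩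
  det N (partMatrix 1ℤ part (const a))
    ≡⟨ det-partMatrix N k 1ℤ part (const a) ⟩
  partDet 1ℤ k (blockDet N part (const a)) (partDeriv N part (const a))
    ≡⟨ partDet-cong 1ℤ k block deriv ⟩
  partDet 1ℤ k (λ Q → E (type Q) * f (type Q)) (λ Q → E (type Q) * + n (type Q))
    ≡⟨ partDet-scale 1ℤ k (E ∘ type) (f ∘ type) ((+_ ∘ n) ∘ type) ⟩
  ∏ k (E ∘ type) * partDet 1ℤ k (f ∘ type) ((+_ ∘ n) ∘ type)
    ≡⟨ cong₂ _*_ (∏-enumΣ-pow s r n a n≥1) (partDet-enumΣ 1ℤ s r f (+_ ∘ n) r≥1) ⟩
  a ^ (nn ∸ k) * (F * (∏ s f + 1ℤ * ∑ s (λ i → (+ r i * + n i) * ∏≠ s i f)))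
    ≡⟨ cong (λ z → a ^ (nn ∸ k) * (F * (∏ s f + z)))
         (trans (ℤ.*-identityˡ _) (∑-cong s (λ i → cong (_* ∏≠ s i f) (sym (ℤ.pos-* (r i) (n i)))))) ⟩
  a ^ (nn ∸ k) * (F * (∏ s f + ∑ s (λ i → + (r i ℕ.* n i) * ∏≠ s i f)))  ∎
  where
  G = completeMultipartite s n r lab
  k = ∑ℕ s r
  nn = ∑ℕ s (λ i → r i ℕ.* n i)
  a = x + 1ℤ
  part = labelledPart s n r lab
  type : Fin k → Fin s
  type = proj₁ ∘ enumΣ s r
  f E : Fin s → ℤ
  f i = a - + 2 * + n i
  E i = a ^ (n i ∸ 1)
  F = ∏ s (λ i → f i ^ (r i ∸ 1))
  entry : ∀ u v → x * δ u v - seidel G u v ≡ partMatrix 1ℤ part (const a) u v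
  entry u v = trans (seidelEntry (samePart (Inverse.to lab u) (Inverse.to lab v)) x (δ u v))
    (cong (λ b → a * δ u v + (1ℤ - + 2 * (if b then 1ℤ else 0ℤ))) (samePart-indexΣ (Inverse.to lab u) (Inverse.to lab v)))
  partSize : ∀ Q → count N part Q ≡ n (type Q)
  partSize = count-labelledPart s n r lab
  deriv : ∀ Q → partDeriv N part (const a) Q ≡ E (type Q) * + n (type Q)
  deriv Q = trans (partDeriv-const N part a Q)
                  (trans (cong (λ c → + c * a ^ (c ∸ 1)) (partSize Q)) (ℤ.*-comm (+ n (type Q)) (E (type Q))))
  block : ∀ Q → blockDet N part (const a) Q ≡ E (type Q) * f (type Q)
  block Q = trans (blockDet-const N part a Q (subst (1 ℕ.≤_) (sym (partSize Q)) (n≥1 (type Q))))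
                  (cong (λ c → a ^ (c ∸ 1) * (a - + 2 * + c)) (partSize Q))
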